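{- Let $\Upsilon_1=\{(1\text{ - }2,0~1),(1\text{ - }2,1~0),(2\text{ - }1,1~0)\}$ and $\Upsilon_2=\{(1\text{ - }2,0~1),(1\text{ - }2,1~0),(2\text{ - }1,1~0),(2\text{ - }1,0~0)\}$. Then for all $n\ge1$ and $k\ge1$: (1) $Av_{n,k}^{\Upsilon_1}=\sum_{\substack{a_1+\cdots+a_k=n\\ a_i\ge0}}a_1!\,a_2!\cdots a_k!$; (2) $Av_{n,k}^{\Upsilon_2}=\binom{n+k-1}{k-1}$.
   Context: For integers $k\ge1$, $n\ge0$, $C_k\wr S_n$ denotes the set of pairs $(\sigma,w)$ where $\sigma=\sigma_1\cdots\sigma_n$ is a permutation of $\{1,\dots,n\}$ in one-line notation and $w=w_1\cdots w_n\in\{0,1,\dots,k-1\}^n$. For a pattern $(\tau,u)$ with $\tau\in S_2$ and $u\in\{00,01,10\}$ (e.g. $(2\text{ - }1,1~0)$ means $\tau=21$, $u=10$), $(\tau,u)$ bi-occurs in $(\sigma,w)$ if there are $1\le i_1<i_2\le n$ (not necessarily adjacent) such that the relative order of $\sigma_{i_1},\sigma_{i_2}$ is that of $\tau$ and the relative order of $w_{i_1},w_{i_2}$ is that of $u$ (for $u=00$: $w_{i_1}=w_{i_2}$; $u=01$: $w_{i_1}<w_{i_2}$; $u=10$: $w_{i_1}>w_{i_2}$). $(\sigma,w)$ bi-avoids a set of patterns if no member bi-occurs in it; $Av_{n,k}^{\Upsilon}$ is the number of elements of $C_k\wr S_n$ bi-avoiding $\Upsilon$. -}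

module Defs where

open import Data.Nat using (ℕ; zero; suc; _+_; _*_; _<_; _≟_; _!)
open import Data.Nat.Properties using (_<?_)
open import Data.Fin using (Fin; toℕ)
open import Data.Fin.Properties using (any?) renaming (_≟_ to _≟ᶠ_)
open import Data.Vec using (Vec; []; _∷_; lookup; toList)
open import Data.List using (List; []; _∷_; length; filter; concatMap; map; sum; product; allFin; cartesianProduct)
open import Data.List.Relation.Unary.Unique.Propositional using (Unique)
open import Data.List.Relation.Unary.Unique.Propositional.Properties using ()
import Data.List.Relation.Unary.Unique.DecPropositional as UD
open import Data.Product using (_×_; _,_; ∃)
open import Relation.Nullary.Decidable using (_×-dec_)
open import Data.Unit using (⊤; tt)
open import Relation.Binary.PropositionalEquality using (_≡_)
open import Relation.Nullary using (¬_; Dec; yes; no)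
open import Relation.Nullary.Decidable using (¬?)

allVecs : (m n : ℕ) → List (Vec (Fin m) n)
allVecs m zero = [] ∷ []
allVecs m (suc n) = concatMap (λ x → map (x ∷_) (allVecs m n)) (allFin m)

-- A permutation of {1..n} in one-line notation (values in Fin n, 0-based):
-- a word of length n with pairwise distinct entries.
IsPerm : ∀ {n} → Vec (Fin n) n → Set
IsPerm σ = Unique (toList σ)

isPerm? : ∀ {n} (σ : Vec (Fin n) n) → Dec (IsPerm σ)
isPerm? σ = UD.unique? _≟ᶠ_ (toList σ)

perms : (n : ℕ) → List (Vec (Fin n) n)
perms n = filter isPerm? (allVecs n n)

-- Elements of C_k ≀ S_n : pairs (σ , w).
colPerms : (n k : ℕ) → List (Vec (Fin n) n × Vec (Fin k) n)
colPerms n k = cartesianProduct (perms n) (allVecs k n)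

data Tau : Set where
  t12 t21 : Tau

data U : Set where
  u00 u01 u10 : U

Pattern : Set
Pattern = Tau × U

τRel : Tau → ℕ → ℕ → Set
τRel t12 a b = a < b
τRel t21 a b = b < a

uRel : U → ℕ → ℕ → Set
uRel u00 a b = a ≡ b
uRel u01 a b = a < b
uRel u10 a b = b < a

BiOccurs : ∀ {n k} → Pattern → Vec (Fin n) n × Vec (Fin k) n → Set
BiOccurs {n} (τ , u) (σ , w) =
  ∃ λ (i₁ : Fin n) → ∃ λ (i₂ : Fin n) → (toℕ i₁ < toℕ i₂)
    × τRel τ (toℕ (lookup σ i₁)) (toℕ (lookup σ i₂))
    × uRel u (toℕ (lookup w i₁)) (toℕ (lookup w i₂))

BiAvoids : ∀ {n k} → List Pattern → Vec (Fin n) n × Vec (Fin k) n → Set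
BiAvoids [] x = ⊤
BiAvoids (p ∷ ps) x = (¬ BiOccurs p x) × BiAvoids ps x

τRel? : ∀ t a b → Dec (τRel t a b)
τRel? t12 a b = a <? b
τRel? t21 a b = b <? a

uRel? : ∀ u a b → Dec (uRel u a b)
uRel? u00 a b = a ≟ b
uRel? u01 a b = a <? b
uRel? u10 a b = b <? a

biOccurs? : ∀ {n k} (p : Pattern) (x : Vec (Fin n) n × Vec (Fin k) n) → Dec (BiOccurs p x)
biOccurs? (τ , u) (σ , w) = any? λ i₁ → any? λ i₂ →
  (toℕ i₁ <? toℕ i₂)
    ×-dec τRel? τ (toℕ (lookup σ i₁)) (toℕ (lookup σ i₂))
    ×-dec uRel? u (toℕ (lookup w i₁)) (toℕ (lookup w i₂))

biAvoids? : ∀ {n k} (ps : List Pattern) (x : Vec (Fin n) n × Vec (Fin k) n) → Dec (BiAvoids ps x)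
biAvoids? [] x = yes tt
biAvoids? (p ∷ ps) x = ¬? (biOccurs? p x) ×-dec biAvoids? ps x

Av : List Pattern → ℕ → ℕ → ℕ
Av Υ n k = length (filter (biAvoids? Υ) (colPerms n k))

Υ₁ : List Pattern
Υ₁ = (t12 , u01) ∷ (t12 , u10) ∷ (t21 , u10) ∷ []

Υ₂ : List Pattern
Υ₂ = (t12 , u01) ∷ (t12 , u10) ∷ (t21 , u10) ∷ (t21 , u00) ∷ []

-- Weak compositions (a₁,…,a_k) of n (aᵢ ≥ 0, Σ aᵢ = n), each aᵢ ≤ n so aᵢ ∈ Fin (suc n).
vsum : ∀ {m k} → Vec (Fin m) k → ℕ
vsum [] = 0
vsum (a ∷ as) = toℕ a + vsum as

compositions : (n k : ℕ) → List (Vec (Fin (suc n)) k)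
compositions n k = filter (λ a → vsum a ≟ n) (allVecs (suc n) k)

factProd : ∀ {m k} → Vec (Fin m) k → ℕ
factProd [] = 1
factProd (a ∷ as) = (toℕ a) ! * factProd as

module Submission where

-- Fix the colour word w and count the permutations σ with (σ , w) bi-avoiding the patterns.
-- Avoiding (1-2,1 0) and (2-1,1 0) forces w to be weakly increasing, and then avoiding
-- (1-2,0 1) says exactly that positions of a larger colour carry smaller values: σ sends the
-- positions of colour c injectively into a fixed interval of multiplicity_w(c) values, these
-- intervals being disjoint.  Hence there are ∏_c multiplicity_w(c)! such σ, and a weakly
-- increasing word is determined by its vector of multiplicities, a weak composition of n into
-- k parts.  The extra pattern (2-1,0 0) of Υ₂ makes σ increasing on each colour, so σ is forced
-- to be the rank function of "larger colour first, then earlier position"; what remains is the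
-- number of weakly increasing words, the multiset coefficient C(n+k-1, k-1).

open import Defs
open import Data.Nat using (ℕ; zero; suc; pred; _+_; _*_; _∸_; _≤_; _<_; _≮_; z≤n; s≤s; s≤s⁻¹; _!; _≟_)
open import Data.Nat.Properties
open import Data.Nat.Tactic.RingSolver using (solve-∀)
open import Data.Nat.Combinatorics using (_C_; nCn≡1; nCk+nC[k+1]≡[n+1]C[k+1])
open import Data.Nat.ListAction using (sum)
open import Data.Fin as F using (Fin; toℕ; fromℕ<) renaming (zero to fz; suc to fs)
import Data.Fin.Properties as FP
open import Data.Vec as V using (Vec; []; _∷_; lookup)
import Data.Vec.Properties as VP
import Data.List as L
import Data.List.Properties as LP
open import Data.List using (List; []; _∷_; _++_; map; concatMap; filter; length; cartesianProduct; allFin)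
open import Data.List.Relation.Unary.All using (All; []; _∷_)
open import Data.List.Relation.Unary.AllPairs using ([]; _∷_)
open import Data.List.Relation.Unary.Unique.Propositional using (Unique)
open import Data.Product using (_×_; _,_; proj₁; proj₂; ∃)
open import Data.Sum using (_⊎_; inj₁; inj₂)
open import Data.Empty using (⊥)
open import Data.Unit using (tt)
open import Function using (_∘_; id; _⇔_; mk⇔; Equivalence)
open import Relation.Binary.Consequences using (tri⇒dec<; tri⇒irr)
open import Relation.Binary.Definitions using (DecidableEquality; Trichotomous; Tri; tri<; tri≈; tri>)
open import Relation.Nullary using (¬_; Dec; yes; no; contradiction)
open import Relation.Nullary.Decidable using (_×-dec_; _→-dec_; ¬?)
open import Algebra.Properties.CommutativeSemigroup +-commutativeSemigroup using () renaming (interchange to +-interchange)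
open import Algebra.Properties.CommutativeSemigroup *-commutativeSemigroup using (x∙yz≈y∙xz; xy∙z≈y∙xz)
open import Relation.Binary.PropositionalEquality
  using (_≡_; _≢_; refl; sym; trans; cong; cong₂; subst; subst₂; module ≡-Reasoning)

⟦_⟧ : ∀ {p} {P : Set p} → Dec P → ℕ
⟦ yes _ ⟧ = 1
⟦ no _ ⟧ = 0

module _ {p} {P : Set p} where

  ⟦⟧-yes : P → (d : Dec P) → ⟦ d ⟧ ≡ 1
  ⟦⟧-yes _ (yes _) = refl
  ⟦⟧-yes p (no ¬p) = contradiction p ¬p

  ⟦⟧-no : ¬ P → (d : Dec P) → ⟦ d ⟧ ≡ 0
  ⟦⟧-no _ (no _) = refl
  ⟦⟧-no ¬p (yes p) = contradiction p ¬p

  ⟦⟧≤1 : (d : Dec P) → ⟦ d ⟧ ≤ 1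
  ⟦⟧≤1 (yes _) = ≤-refl
  ⟦⟧≤1 (no _) = z≤n

⟦⟧-mono : ∀ {p q} {P : Set p} {Q : Set q} → (P → Q) → (a : Dec P) (b : Dec Q) → ⟦ a ⟧ ≤ ⟦ b ⟧
⟦⟧-mono f (yes p) b = ≤-reflexive (sym (⟦⟧-yes (f p) b))
⟦⟧-mono f (no _) b = z≤n

module _ {p q} {P : Set p} {Q : Set q} where

  ⟦⟧-cong : (P → Q) → (Q → P) → (a : Dec P) (b : Dec Q) → ⟦ a ⟧ ≡ ⟦ b ⟧
  ⟦⟧-cong f g a b = ≤-antisym (⟦⟧-mono f a b) (⟦⟧-mono g b a)

  ⟦⟧-× : (a : Dec P) (b : Dec Q) (c : Dec (P × Q)) → ⟦ c ⟧ ≡ ⟦ a ⟧ * ⟦ b ⟧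
  ⟦⟧-× (yes p) (yes q) c = ⟦⟧-yes (p , q) c
  ⟦⟧-× (yes _) (no ¬q) c = ⟦⟧-no (¬q ∘ proj₂) c
  ⟦⟧-× (no ¬p) _ c = ⟦⟧-no (¬p ∘ proj₁) c

  ⟦⟧-cover : (¬ P → Q) → (a : Dec P) (b : Dec Q) → 1 ≤ ⟦ a ⟧ + ⟦ b ⟧
  ⟦⟧-cover f (yes _) b = s≤s z≤n
  ⟦⟧-cover f (no ¬p) b = ≤-reflexive (sym (⟦⟧-yes (f ¬p) b))

  ⟦⟧-complement : (P → ¬ Q) → (¬ P → Q) → (a : Dec P) (b : Dec Q) → ⟦ a ⟧ + ⟦ b ⟧ ≡ 1
  ⟦⟧-complement f g (yes p) b = cong suc (⟦⟧-no (f p) b)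
  ⟦⟧-complement f g (no ¬p) b = ⟦⟧-yes (g ¬p) b

  ⟦⟧-split : (a : Dec P) (b : Dec Q) → ⟦ b ⟧ ≡ ⟦ a ×-dec b ⟧ + ⟦ ¬? a ×-dec b ⟧
  ⟦⟧-split (yes _) (yes _) = refl
  ⟦⟧-split (no _) (yes _) = refl
  ⟦⟧-split (yes _) (no _) = refl
  ⟦⟧-split (no _) (no _) = refl

⟦⟧-trichotomy : ∀ {a b c} {A : Set a} {B : Set b} {C : Set c} →
  (A → ¬ B) → (A → ¬ C) → (B → ¬ C) → (¬ A → ¬ B → C) →
  (x : Dec A) (y : Dec B) (z : Dec C) → ⟦ x ⟧ + ⟦ y ⟧ + ⟦ z ⟧ ≡ 1
⟦⟧-trichotomy f g h e (yes a) y z = cong₂ (λ u v → suc (u + v)) (⟦⟧-no (f a) y) (⟦⟧-no (g a) z)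
⟦⟧-trichotomy f g h e (no _) (yes b) z = cong suc (⟦⟧-no (h b) z)
⟦⟧-trichotomy f g h e (no ¬a) (no ¬b) z = ⟦⟧-yes (e ¬a ¬b) z

∑ : ∀ {a} {A : Set a} → List A → (A → ℕ) → ℕ
∑ [] f = 0
∑ (x ∷ xs) f = f x + ∑ xs f

syntax ∑ xs (λ x → e) = ∑[ x ∈ xs ] e

∑< : ∀ n → (Fin n → ℕ) → ℕ
∑< n = ∑ (allFin n)

syntax ∑< n (λ i → e) = ∑[ i < n ] e

module _ {a} {A : Set a} where

  ∑-cong : ∀ (xs : List A) {f g : A → ℕ} → (∀ x → f x ≡ g x) → ∑ xs f ≡ ∑ xs g
  ∑-cong [] e = refl
  ∑-cong (x ∷ xs) e = cong₂ _+_ (e x) (∑-cong xs e)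

  ∑-zero : ∀ (xs : List A) {f : A → ℕ} → (∀ x → f x ≡ 0) → ∑ xs f ≡ 0
  ∑-zero [] e = refl
  ∑-zero (x ∷ xs) e = cong₂ _+_ (e x) (∑-zero xs e)

  ∑-mono : ∀ (xs : List A) {f g : A → ℕ} → (∀ x → f x ≤ g x) → ∑ xs f ≤ ∑ xs g
  ∑-mono [] e = z≤n
  ∑-mono (x ∷ xs) e = +-mono-≤ (e x) (∑-mono xs e)

  ∑-+ : ∀ (xs : List A) (f g : A → ℕ) → ∑[ x ∈ xs ] (f x + g x) ≡ ∑ xs f + ∑ xs g
  ∑-+ [] f g = refl
  ∑-+ (x ∷ xs) f g =
    trans (cong (f x + g x +_) (∑-+ xs f g)) (+-interchange (f x) (g x) _ _)

  ∑-*ˡ : ∀ (xs : List A) (c : ℕ) (f : A → ℕ) → ∑[ x ∈ xs ] (c * f x) ≡ c * ∑ xs f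
  ∑-*ˡ [] c f = sym (*-zeroʳ c)
  ∑-*ˡ (x ∷ xs) c f = trans (cong (c * f x +_) (∑-*ˡ xs c f)) (sym (*-distribˡ-+ c (f x) _))

  ∑-*ʳ : ∀ (xs : List A) (c : ℕ) (f : A → ℕ) → ∑[ x ∈ xs ] (f x * c) ≡ ∑ xs f * c
  ∑-*ʳ xs c f = begin
    ∑[ x ∈ xs ] (f x * c) ≡⟨ ∑-cong xs (λ x → *-comm (f x) c) ⟩
    ∑[ x ∈ xs ] (c * f x) ≡⟨ ∑-*ˡ xs c f ⟩
    c * ∑ xs f            ≡⟨ *-comm c _ ⟩
    ∑ xs f * c            ∎
    where open ≡-Reasoning

  ∑-++ : ∀ (xs ys : List A) (f : A → ℕ) → ∑ (xs ++ ys) f ≡ ∑ xs f + ∑ ys f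
  ∑-++ [] ys f = refl
  ∑-++ (x ∷ xs) ys f = trans (cong (f x +_) (∑-++ xs ys f)) (sym (+-assoc (f x) _ _))

  ∑-filter : ∀ {p} {P : A → Set p} (P? : ∀ x → Dec (P x)) (xs : List A) (f : A → ℕ) →
    ∑ (filter P? xs) f ≡ ∑[ x ∈ xs ] (⟦ P? x ⟧ * f x)
  ∑-filter P? [] f = refl
  ∑-filter P? (x ∷ xs) f with P? x
  ... | yes _ = cong₂ _+_ (sym (+-identityʳ (f x))) (∑-filter P? xs f)
  ... | no _ = ∑-filter P? xs f

  length-filter : ∀ {p} {P : A → Set p} (P? : ∀ x → Dec (P x)) (xs : List A) →
    length (filter P? xs) ≡ ∑[ x ∈ xs ] ⟦ P? x ⟧
  length-filter P? [] = refl
  length-filter P? (x ∷ xs) with P? x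
  ... | yes _ = cong suc (length-filter P? xs)
  ... | no _ = length-filter P? xs

  sum-map : ∀ (f : A → ℕ) (xs : List A) → sum (map f xs) ≡ ∑ xs f
  sum-map f [] = refl
  sum-map f (x ∷ xs) = cong (f x +_) (sum-map f xs)

module _ {a b} {A : Set a} {B : Set b} where

  ∑-map : ∀ (g : A → B) (xs : List A) (f : B → ℕ) → ∑ (map g xs) f ≡ ∑ xs (f ∘ g)
  ∑-map g [] f = refl
  ∑-map g (x ∷ xs) f = cong (f (g x) +_) (∑-map g xs f)

  ∑-concatMap : ∀ (g : A → List B) (xs : List A) (f : B → ℕ) →
    ∑ (concatMap g xs) f ≡ ∑[ x ∈ xs ] ∑ (g x) f
  ∑-concatMap g [] f = refl
  ∑-concatMap g (x ∷ xs) f =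
    trans (∑-++ (g x) (concatMap g xs) f) (cong (∑ (g x) f +_) (∑-concatMap g xs f))

  ∑-comm : ∀ (xs : List A) (ys : List B) (f : A → B → ℕ) →
    ∑[ x ∈ xs ] ∑[ y ∈ ys ] f x y ≡ ∑[ y ∈ ys ] ∑[ x ∈ xs ] f x y
  ∑-comm [] ys f = sym (∑-zero ys (λ _ → refl))
  ∑-comm (x ∷ xs) ys f =
    trans (cong (∑ ys (f x) +_) (∑-comm xs ys f)) (sym (∑-+ ys (f x) _))


∑-cartesianProduct : ∀ {a b} {A : Set a} {B : Set b} (xs : List A) (ys : List B) (f : A × B → ℕ) →
  ∑ (cartesianProduct xs ys) f ≡ ∑[ x ∈ xs ] ∑[ y ∈ ys ] f (x , y)
∑-cartesianProduct [] ys f = refl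
∑-cartesianProduct (x ∷ xs) ys f = trans (∑-++ (map (x ,_) ys) _ f)
  (cong₂ _+_ (∑-map (x ,_) ys f) (∑-cartesianProduct xs ys f))

∑<-suc : ∀ n (f : Fin (suc n) → ℕ) → ∑< (suc n) f ≡ f fz + ∑< n (f ∘ fs)
∑<-suc n f = cong (f fz +_) (begin
  ∑ (L.tabulate fs) f        ≡⟨ cong (λ xs → ∑ xs f) (sym (LP.map-tabulate id fs)) ⟩
  ∑ (map fs (allFin n)) f   ≡⟨ ∑-map fs (allFin n) f ⟩
  ∑< n (f ∘ fs)             ∎)
  where open ≡-Reasoning

∑<-cong : ∀ n {f g : Fin n → ℕ} → (∀ i → f i ≡ g i) → ∑< n f ≡ ∑< n g
∑<-cong n = ∑-cong (allFin n)

∑<-1 : ∀ n → ∑[ _ < n ] 1 ≡ n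
∑<-1 zero = refl
∑<-1 (suc n) = trans (∑<-suc n (λ _ → 1)) (cong suc (∑<-1 n))

term≤∑< : ∀ n (f : Fin n → ℕ) (i : Fin n) → f i ≤ ∑< n f
term≤∑< (suc n) f fz = m≤m+n (f fz) _
term≤∑< (suc n) f (fs i) = begin
  f (fs i)              ≤⟨ term≤∑< n (f ∘ fs) i ⟩
  ∑< n (f ∘ fs)         ≤⟨ m≤n+m _ (f fz) ⟩
  f fz + ∑< n (f ∘ fs)  ≡⟨ sym (∑<-suc n f) ⟩
  ∑< (suc n) f          ∎
  where open ≤-Reasoning

∑<-δ : ∀ n (a : Fin n) (f : Fin n → ℕ) → ∑[ i < n ] (⟦ a F.≟ i ⟧ * f i) ≡ f a
∑<-δ (suc n) fz f = begin
  ∑[ i < suc n ] (⟦ fz F.≟ i ⟧ * f i)          ≡⟨ ∑<-suc n (λ i → ⟦ fz F.≟ i ⟧ * f i) ⟩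
  f fz + 0 + ∑[ i < n ] (⟦ fz F.≟ fs i ⟧ * f (fs i))
    ≡⟨ cong (f fz + 0 +_) (∑-zero (allFin n) (λ i → cong (_* f (fs i)) (⟦⟧-no (λ ()) (fz F.≟ fs i)))) ⟩
  f fz + 0 + 0                                 ≡⟨ +-identityʳ _ ⟩
  f fz + 0                                     ≡⟨ +-identityʳ _ ⟩
  f fz                                         ∎
  where open ≡-Reasoning
∑<-δ (suc n) (fs a) f = begin
  ∑[ i < suc n ] (⟦ fs a F.≟ i ⟧ * f i)                 ≡⟨ ∑<-suc n (λ i → ⟦ fs a F.≟ i ⟧ * f i) ⟩
  ∑[ i < n ] (⟦ fs a F.≟ fs i ⟧ * f (fs i))
    ≡⟨ ∑<-cong n (λ i → cong (_* f (fs i)) (⟦⟧-cong FP.suc-injective (cong fs) (fs a F.≟ fs i) (a F.≟ i))) ⟩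
  ∑[ i < n ] (⟦ a F.≟ i ⟧ * f (fs i))                   ≡⟨ ∑<-δ n a (f ∘ fs) ⟩
  f (fs a)                                              ∎
  where open ≡-Reasoning

count-≟ : ∀ n (a : Fin n) → ∑[ i < n ] ⟦ a F.≟ i ⟧ ≡ 1
count-≟ n a = trans (∑<-cong n (λ i → sym (*-identityʳ _))) (∑<-δ n a (λ _ → 1))

count : ∀ {n p} {P : Fin n → Set p} → (∀ i → Dec (P i)) → ℕ
count {n} P? = ∑[ i < n ] ⟦ P? i ⟧

module _ {n p q} {P : Fin n → Set p} {Q : Fin n → Set q} where

  count-cong : (P? : ∀ i → Dec (P i)) (Q? : ∀ i → Dec (Q i)) →
    (∀ i → P i → Q i) → (∀ i → Q i → P i) → count P? ≡ count Q?
  count-cong P? Q? f g = ∑<-cong n (λ i → ⟦⟧-cong (f i) (g i) (P? i) (Q? i))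

  count-mono : (P? : ∀ i → Dec (P i)) (Q? : ∀ i → Dec (Q i)) →
    (∀ i → P i → Q i) → count P? ≤ count Q?
  count-mono P? Q? f = ∑-mono (allFin n) (λ i → ⟦⟧-mono (f i) (P? i) (Q? i))

module _ {n p q} {P : Fin n → Set p} {Q : Fin n → Set q}
         (P? : ∀ i → Dec (P i)) (Q? : ∀ i → Dec (Q i)) where

  count-split : count Q? ≡ count (λ i → P? i ×-dec Q? i) + count (λ i → ¬? (P? i) ×-dec Q? i)
  count-split = trans (∑<-cong n (λ i → ⟦⟧-split (P? i) (Q? i))) (∑-+ (allFin n) _ _)

  count-strict-mono : (∀ i → P i → Q i) → (j : Fin n) → Q j → ¬ P j → count P? < count Q?
  count-strict-mono f j qj ¬pj = begin-strict
    count P?                                 <⟨ m<m+n _ R?-positive ⟩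
    count P? + count R?                      ≡⟨ cong (_+ count R?) P≡P∧Q ⟩
    count (λ i → P? i ×-dec Q? i) + count R? ≡⟨ sym count-split ⟩
    count Q?                                 ∎
    where
    open ≤-Reasoning
    R? : ∀ i → Dec (¬ P i × Q i)
    R? i = ¬? (P? i) ×-dec Q? i
    R?-positive : 0 < count R?
    R?-positive = ≤-trans (≤-reflexive (sym (⟦⟧-yes (¬pj , qj) (R? j)))) (term≤∑< n (λ i → ⟦ R? i ⟧) j)
    P≡P∧Q : count P? ≡ count (λ i → P? i ×-dec Q? i)
    P≡P∧Q = count-cong P? (λ i → P? i ×-dec Q? i) (λ i p → p , f i p) (λ _ → proj₁)

count-toℕ< : ∀ m h → h ≤ m → count (λ (x : Fin m) → toℕ x <? h) ≡ h
count-toℕ< zero zero _ = refl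
count-toℕ< (suc m) zero _ = ∑-zero (allFin (suc m)) (λ x → ⟦⟧-no (λ ()) (toℕ x <? 0))
count-toℕ< (suc m) (suc h) (s≤s h≤m) = begin
  count (λ (x : Fin (suc m)) → toℕ x <? suc h)   ≡⟨ ∑<-suc m (λ x → ⟦ toℕ x <? suc h ⟧) ⟩
  1 + count (λ (x : Fin m) → suc (toℕ x) <? suc h)
    ≡⟨ cong suc (count-cong (λ (x : Fin m) → suc (toℕ x) <? suc h) (λ x → toℕ x <? h)
                            (λ _ → s≤s⁻¹) (λ _ → s≤s)) ⟩
  1 + count (λ (x : Fin m) → toℕ x <? h)         ≡⟨ cong suc (count-toℕ< m h h≤m) ⟩
  suc h                                          ∎
  where open ≡-Reasoning

count-≤toℕ : ∀ m h → h ≤ m → count (λ (x : Fin m) → h ≤? toℕ x) ≡ m ∸ h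
count-≤toℕ m h h≤m = sym (begin
  m ∸ h                                              ≡⟨ cong (_∸ h) (sym everything) ⟩
  ∑[ x < m ] (⟦ toℕ x <? h ⟧ + ⟦ h ≤? toℕ x ⟧) ∸ h    ≡⟨ cong (_∸ h) (∑-+ (allFin m) _ _) ⟩
  count (λ (x : Fin m) → toℕ x <? h) + count (λ (x : Fin m) → h ≤? toℕ x) ∸ h
    ≡⟨ cong (λ c → c + count (λ (x : Fin m) → h ≤? toℕ x) ∸ h) (count-toℕ< m h h≤m) ⟩
  h + count (λ (x : Fin m) → h ≤? toℕ x) ∸ h         ≡⟨ m+n∸m≡n h _ ⟩
  count (λ (x : Fin m) → h ≤? toℕ x)                 ∎)
  where
  open ≡-Reasoning
  everything : ∑[ x < m ] (⟦ toℕ x <? h ⟧ + ⟦ h ≤? toℕ x ⟧) ≡ m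
  everything = trans (∑<-cong m (λ x → ⟦⟧-complement <⇒≱ ≮⇒≥ (toℕ x <? h) (h ≤? toℕ x))) (∑<-1 m)

count-interval : ∀ m lo hi → hi ≤ m →
  count (λ (x : Fin m) → (lo ≤? toℕ x) ×-dec (toℕ x <? hi)) ≡ hi ∸ lo
count-interval m lo hi hi≤m with lo ≤? hi
... | no lo≰hi = trans
  (∑-zero (allFin m) (λ x → ⟦⟧-no (λ (lo≤x , x<hi) → lo≰hi (≤-trans lo≤x (<⇒≤ x<hi))) (I? x)))
  (sym (m≤n⇒m∸n≡0 (<⇒≤ (≰⇒> lo≰hi))))
  where
  I? : ∀ (x : Fin m) → Dec (lo ≤ toℕ x × toℕ x < hi)
  I? x = (lo ≤? toℕ x) ×-dec (toℕ x <? hi)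
... | yes lo≤hi = +-cancelˡ-≡ lo _ _ (begin
  lo + count I?                                           ≡⟨ cong₂ _+_ (sym below-lo) (sym from-lo) ⟩
  count (λ x → B? x ×-dec H? x) + count (λ x → ¬? (B? x) ×-dec H? x) ≡⟨ sym (count-split B? H?) ⟩
  count H?                                                ≡⟨ count-toℕ< m hi hi≤m ⟩
  hi                                                      ≡⟨ sym (m+[n∸m]≡n lo≤hi) ⟩
  lo + (hi ∸ lo)                                          ∎)
  where
  open ≡-Reasoning
  B? H? : ∀ (x : Fin m) → Dec _
  B? x = toℕ x <? lo
  H? x = toℕ x <? hi
  I? : ∀ (x : Fin m) → Dec (lo ≤ toℕ x × toℕ x < hi)
  I? x = (lo ≤? toℕ x) ×-dec (toℕ x <? hi)
  below-lo : count (λ x → B? x ×-dec H? x) ≡ lo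
  below-lo = trans (count-cong (λ x → B? x ×-dec H? x) B? (λ _ → proj₁) (λ _ x<lo → x<lo , <-≤-trans x<lo lo≤hi))
                   (count-toℕ< m lo (≤-trans lo≤hi hi≤m))
  from-lo : count (λ x → ¬? (B? x) ×-dec H? x) ≡ count I?
  from-lo = count-cong (λ x → ¬? (B? x) ×-dec H? x) I? (λ _ (x≮lo , x<hi) → ≮⇒≥ x≮lo , x<hi)
                       (λ _ (lo≤x , x<hi) → (λ x<lo → <⇒≱ x<lo lo≤x) , x<hi)

count-fibre≤1 : ∀ {L m} (f : Fin L → Fin m) → (∀ i j → f i ≡ f j → i ≡ j) →
  ∀ x → count (λ l → f l F.≟ x) ≤ 1
count-fibre≤1 {zero} f inj x = z≤n
count-fibre≤1 {suc L} f inj x = ≤-trans (≤-reflexive (∑<-suc L (λ l → ⟦ f l F.≟ x ⟧))) (head (f fz F.≟ x))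
  where
  tail-inj : ∀ i j → f (fs i) ≡ f (fs j) → i ≡ j
  tail-inj i j e = FP.suc-injective (inj (fs i) (fs j) e)
  head : Dec (f fz ≡ x) → ⟦ f fz F.≟ x ⟧ + count (λ l → f (fs l) F.≟ x) ≤ 1
  head (yes e) = ≤-reflexive (cong₂ _+_ (⟦⟧-yes e (f fz F.≟ x))
    (∑-zero (allFin L) (λ l → ⟦⟧-no (λ e′ → fs≢fz (inj (fs l) fz (trans e′ (sym e)))) (f (fs l) F.≟ x))))
    where fs≢fz : ∀ {l : Fin L} → fs l ≢ fz
          fs≢fz ()
  head (no ne) = ≤-trans (≤-reflexive (cong (_+ count (λ l → f (fs l) F.≟ x)) (⟦⟧-no ne (f fz F.≟ x))))
                         (count-fibre≤1 (f ∘ fs) tail-inj x)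

count-≤-injection : ∀ {L m p q} {P : Fin L → Set p} {Q : Fin m → Set q}
  (σ : Fin L → Fin m) → (∀ i j → σ i ≡ σ j → i ≡ j) →
  (P? : ∀ l → Dec (P l)) (Q? : ∀ x → Dec (Q x)) →
  (∀ l → P l → Q (σ l)) → count P? ≤ count Q?
count-≤-injection {L} {m} σ inj P? Q? f = begin
  count P?                                               ≤⟨ count-mono P? (Q? ∘ σ) f ⟩
  ∑[ l < L ] ⟦ Q? (σ l) ⟧
    ≡⟨ ∑<-cong L (λ l → sym (∑<-δ m (σ l) (λ x → ⟦ Q? x ⟧))) ⟩
  ∑[ l < L ] ∑[ x < m ] (⟦ σ l F.≟ x ⟧ * ⟦ Q? x ⟧)        ≡⟨ ∑-comm (allFin L) (allFin m) _ ⟩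
  ∑[ x < m ] ∑[ l < L ] (⟦ σ l F.≟ x ⟧ * ⟦ Q? x ⟧)        ≡⟨ ∑<-cong m (λ x → ∑-*ʳ (allFin L) _ _) ⟩
  ∑[ x < m ] (count (λ l → σ l F.≟ x) * ⟦ Q? x ⟧)
    ≤⟨ ∑-mono (allFin m) (λ x → *-monoˡ-≤ ⟦ Q? x ⟧ (count-fibre≤1 σ inj x)) ⟩
  ∑[ x < m ] (1 * ⟦ Q? x ⟧)                              ≡⟨ ∑<-cong m (λ x → *-identityˡ _) ⟩
  count Q?                                               ∎
  where open ≤-Reasoning

module _ {L m p} {P : Fin L → Set p} (σ : Fin L → Fin m) (σ-inj : ∀ i j → σ i ≡ σ j → i ≡ j)
         (P? : ∀ l → Dec (P l)) where

  count≤value : ∀ v → v ≤ m → (∀ l → P l → toℕ (σ l) < v) → count P? ≤ v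
  count≤value v v≤m below = ≤-trans (count-≤-injection σ σ-inj P? (λ x → toℕ x <? v) below)
                                    (≤-reflexive (count-toℕ< m v v≤m))

  count≤room-above : ∀ v → v < m → (∀ l → P l → v < toℕ (σ l)) → count P? ≤ m ∸ suc v
  count≤room-above v v<m above = ≤-trans (count-≤-injection σ σ-inj P? (λ x → suc v ≤? toℕ x) above)
                                         (≤-reflexive (count-≤toℕ m (suc v) v<m))

module Rank {n ℓ} (_≺_ : Fin n → Fin n → Set ℓ) (≺-trans : ∀ {i j l} → i ≺ j → j ≺ l → i ≺ l)
            (compare : Trichotomous _≡_ _≺_) where

  _≺?_ : ∀ i j → Dec (i ≺ j)
  _≺?_ = tri⇒dec< compare

  ≺-irrefl : ∀ {i} → ¬ i ≺ i
  ≺-irrefl = tri⇒irr compare refl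

  rank : Fin n → ℕ
  rank i = count (λ l → l ≺? i)

  rank-mono : ∀ {i j} → i ≺ j → rank i < rank j
  rank-mono {i} {j} i≺j =
    count-strict-mono (λ l → l ≺? i) (λ l → l ≺? j) (λ _ l≺i → ≺-trans l≺i i≺j) i i≺j ≺-irrefl

  rank-injective : ∀ i j → rank i ≡ rank j → i ≡ j
  rank-injective i j e with compare i j
  ... | tri< i≺j _ _ = contradiction e (<⇒≢ (rank-mono i≺j))
  ... | tri≈ _ i≡j _ = i≡j
  ... | tri> _ _ j≺i = contradiction (sym e) (<⇒≢ (rank-mono j≺i))

  higher : Fin n → ℕ
  higher i = count (λ l → i ≺? l)

  higher+suc-rank : ∀ i → higher i + suc (rank i) ≡ n
  higher+suc-rank i = begin
    higher i + suc (rank i)                     ≡⟨ cong (higher i +_) (+-comm 1 (rank i)) ⟩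
    higher i + (rank i + 1)                     ≡⟨ sym (+-assoc (higher i) (rank i) 1) ⟩
    higher i + rank i + 1                       ≡⟨ cong (higher i + rank i +_) (sym (count-≟ n i)) ⟩
    higher i + rank i + count (λ l → i F.≟ l)
      ≡⟨ sym (trans (∑-+ (allFin n) _ _) (cong (_+ count (λ l → i F.≟ l)) (∑-+ (allFin n) _ _))) ⟩
    ∑[ l < n ] (⟦ i ≺? l ⟧ + ⟦ l ≺? i ⟧ + ⟦ i F.≟ l ⟧)
      ≡⟨ ∑<-cong n (λ l → ⟦⟧-trichotomy (λ i≺l l≺i → ≺-irrefl (≺-trans l≺i i≺l))
                                        (λ { i≺l refl → ≺-irrefl i≺l }) (λ { l≺i refl → ≺-irrefl l≺i })
                                        (exactly-one l) (i ≺? l) (l ≺? i) (i F.≟ l)) ⟩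
    ∑[ _ < n ] 1                                ≡⟨ ∑<-1 n ⟩
    n                                           ∎
    where
    open ≡-Reasoning
    exactly-one : ∀ l → ¬ i ≺ l → ¬ l ≺ i → i ≡ l
    exactly-one l i⊀l l⊀i with compare i l
    ... | tri< i≺l _ _ = contradiction i≺l i⊀l
    ... | tri≈ _ i≡l _ = i≡l
    ... | tri> _ _ l≺i = contradiction l≺i l⊀i

  rank<n : ∀ i → rank i < n
  rank<n i = ≤-trans (m≤n+m (suc (rank i)) (higher i)) (≤-reflexive (higher+suc-rank i))

  -- the rank i values below σ i and the higher i values above it already fill Fin n
  monotone⇒rank : (σ : Fin n → Fin n) → (∀ i j → σ i ≡ σ j → i ≡ j) →
    (∀ l i → l ≺ i → toℕ (σ l) < toℕ (σ i)) → ∀ i → toℕ (σ i) ≡ rank i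
  monotone⇒rank σ σ-inj mono i = ≤-antisym (s≤s⁻¹ (+-cancelˡ-≤ (higher i) _ _ fits)) below
    where
    open ≤-Reasoning
    σi<n = FP.toℕ<n (σ i)
    below : rank i ≤ toℕ (σ i)
    below = count≤value σ σ-inj (λ l → l ≺? i) (toℕ (σ i)) (<⇒≤ σi<n) (λ l l≺i → mono l i l≺i)
    above : higher i ≤ n ∸ suc (toℕ (σ i))
    above = count≤room-above σ σ-inj (λ l → i ≺? l) (toℕ (σ i)) σi<n (mono i)
    fits : higher i + suc (toℕ (σ i)) ≤ higher i + suc (rank i)
    fits = begin
      higher i + suc (toℕ (σ i))  ≤⟨ m≤o∸n⇒m+n≤o (higher i) σi<n above ⟩
      n                           ≡⟨ sym (higher+suc-rank i) ⟩
      higher i + suc (rank i)     ∎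

Distinct : ∀ {a} {A : Set a} {L} → Vec A L → Set a
Distinct σ = ∀ i j → lookup σ i ≡ lookup σ j → i ≡ j

distinct? : ∀ {m L} (σ : Vec (Fin m) L) → Dec (Distinct σ)
distinct? σ = FP.all? (λ i → FP.all? (λ j → (lookup σ i F.≟ lookup σ j) →-dec (i F.≟ j)))

module _ {a} {A : Set a} where

  distinct-∷⁻ : ∀ {L} (x : A) (σ : Vec A L) → Distinct (x ∷ σ) → (∀ j → lookup σ j ≢ x) × Distinct σ
  distinct-∷⁻ x σ d = (λ j e → fs≢fz (d (fs j) fz e)) , (λ i j e → FP.suc-injective (d (fs i) (fs j) e))
    where fs≢fz : ∀ {L} {j : Fin L} → fs j ≢ fz
          fs≢fz ()

  distinct-∷⁺ : ∀ {L} (x : A) (σ : Vec A L) → (∀ j → lookup σ j ≢ x) → Distinct σ → Distinct (x ∷ σ)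
  distinct-∷⁺ x σ ne d fz fz e = refl
  distinct-∷⁺ x σ ne d fz (fs j) e = contradiction (sym e) (ne j)
  distinct-∷⁺ x σ ne d (fs i) fz e = contradiction e (ne i)
  distinct-∷⁺ x σ ne d (fs i) (fs j) e = cong fs (d i j e)

  private
    All-lookup : ∀ {p} {P : A → Set p} {L} (σ : Vec A L) → All P (V.toList σ) → ∀ j → P (lookup σ j)
    All-lookup (x ∷ σ) (px ∷ _) fz = px
    All-lookup (x ∷ σ) (_ ∷ ps) (fs j) = All-lookup σ ps j

    lookup-All : ∀ {p} {P : A → Set p} {L} (σ : Vec A L) → (∀ j → P (lookup σ j)) → All P (V.toList σ)
    lookup-All [] f = []
    lookup-All (x ∷ σ) f = f fz ∷ lookup-All σ (f ∘ fs)

  Unique⇒Distinct : ∀ {L} (σ : Vec A L) → Unique (V.toList σ) → Distinct σ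
  Unique⇒Distinct [] u ()
  Unique⇒Distinct (x ∷ σ) (x∉σ ∷ u) =
    distinct-∷⁺ x σ (λ j e → All-lookup σ x∉σ j (sym e)) (Unique⇒Distinct σ u)

  Distinct⇒Unique : ∀ {L} (σ : Vec A L) → Distinct σ → Unique (V.toList σ)
  Distinct⇒Unique [] d = []
  Distinct⇒Unique (x ∷ σ) d = let (x∉σ , d′) = distinct-∷⁻ x σ d in
    lookup-All σ (λ j e → x∉σ j (sym e)) ∷ Distinct⇒Unique σ d′

∑-allVecs-suc : ∀ m n (f : Vec (Fin m) (suc n) → ℕ) →
  ∑ (allVecs m (suc n)) f ≡ ∑[ x < m ] ∑[ v ∈ allVecs m n ] f (x ∷ v)
∑-allVecs-suc m n f = trans (∑-concatMap (λ x → map (x ∷_) (allVecs m n)) (allFin m) f)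
  (∑<-cong m (λ x → ∑-map (x ∷_) (allVecs m n) f))

infix 4 _≟ᵛ_
_≟ᵛ_ : ∀ {m n} → DecidableEquality (Vec (Fin m) n)
_≟ᵛ_ = VP.≡-dec F._≟_

∑-allVecs-δ : ∀ m n (u : Vec (Fin m) n) (h : Vec (Fin m) n → ℕ) →
  ∑[ v ∈ allVecs m n ] (⟦ u ≟ᵛ v ⟧ * h v) ≡ h u
∑-allVecs-δ m zero [] h = trans (+-identityʳ _) (+-identityʳ _)
∑-allVecs-δ m (suc n) (y ∷ u) h = begin
  ∑[ v ∈ allVecs m (suc n) ] (⟦ y ∷ u ≟ᵛ v ⟧ * h v)                         ≡⟨ ∑-allVecs-suc m n _ ⟩
  ∑[ x < m ] ∑[ v ∈ allVecs m n ] (⟦ y ∷ u ≟ᵛ x ∷ v ⟧ * h (x ∷ v))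
    ≡⟨ ∑<-cong m (λ x → ∑-cong (allVecs m n) (λ v → cong (_* h (x ∷ v)) (split x v))) ⟩
  ∑[ x < m ] ∑[ v ∈ allVecs m n ] (⟦ y F.≟ x ⟧ * ⟦ u ≟ᵛ v ⟧ * h (x ∷ v))
    ≡⟨ ∑<-cong m (λ x → trans (∑-cong (allVecs m n) (λ v → *-assoc ⟦ y F.≟ x ⟧ _ _))
                              (∑-*ˡ (allVecs m n) ⟦ y F.≟ x ⟧ _)) ⟩
  ∑[ x < m ] (⟦ y F.≟ x ⟧ * ∑[ v ∈ allVecs m n ] (⟦ u ≟ᵛ v ⟧ * h (x ∷ v)))   ≡⟨ ∑<-δ m y _ ⟩
  ∑[ v ∈ allVecs m n ] (⟦ u ≟ᵛ v ⟧ * h (y ∷ v))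
    ≡⟨ ∑-allVecs-δ m n u (h ∘ (y ∷_)) ⟩
  h (y ∷ u)                                                                 ∎
  where
  open ≡-Reasoning
  split : ∀ x v → ⟦ y ∷ u ≟ᵛ x ∷ v ⟧ ≡ ⟦ y F.≟ x ⟧ * ⟦ u ≟ᵛ v ⟧
  split x v = trans (⟦⟧-cong VP.∷-injective (λ (e , e′) → cong₂ _∷_ e e′)
                             (y ∷ u ≟ᵛ x ∷ v) ((y F.≟ x) ×-dec (u ≟ᵛ v)))
                    (⟦⟧-× (y F.≟ x) (u ≟ᵛ v) _)

∏< : ∀ n → (Fin n → ℕ) → ℕ
∏< zero f = 1
∏< (suc n) f = f fz * ∏< n (f ∘ fs)

syntax ∏< n (λ i → e) = ∏[ i < n ] e

∏<-cong : ∀ n {f g : Fin n → ℕ} → (∀ i → f i ≡ g i) → ∏< n f ≡ ∏< n g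
∏<-cong zero e = refl
∏<-cong (suc n) e = cong₂ _*_ (e fz) (∏<-cong n (e ∘ fs))

∏<-1 : ∀ n → ∏[ _ < n ] 1 ≡ 1
∏<-1 zero = refl
∏<-1 (suc n) = trans (+-identityʳ _) (∏<-1 n)

∏<-update : ∀ n (f g : Fin n → ℕ) (b : Fin n) (a : ℕ) →
  (∀ i → i ≢ b → f i ≡ g i) → a * f b ≡ g b → a * ∏< n f ≡ ∏< n g
∏<-update (suc n) f g fz a same at-b = begin
  a * (f fz * ∏< n (f ∘ fs))   ≡⟨ sym (*-assoc a _ _) ⟩
  a * f fz * ∏< n (f ∘ fs)     ≡⟨ cong₂ _*_ at-b (∏<-cong n (λ i → same (fs i) (λ ()))) ⟩
  g fz * ∏< n (g ∘ fs)         ∎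
  where open ≡-Reasoning
∏<-update (suc n) f g (fs b) a same at-b = begin
  a * (f fz * ∏< n (f ∘ fs))   ≡⟨ x∙yz≈y∙xz a (f fz) _ ⟩
  f fz * (a * ∏< n (f ∘ fs))
    ≡⟨ cong₂ _*_ (same fz (λ ()))
                 (∏<-update n (f ∘ fs) (g ∘ fs) b a (λ i i≢b → same (fs i) (i≢b ∘ FP.suc-injective)) at-b) ⟩
  g fz * ∏< n (g ∘ fs)         ∎
  where open ≡-Reasoning

multiplicity : ∀ {k L} → Vec (Fin k) L → Fin k → ℕ
multiplicity v c = count (λ j → lookup v j F.≟ c)

multiplicity-∷ : ∀ {k L} (b : Fin k) (v : Vec (Fin k) L) c →
  multiplicity (b ∷ v) c ≡ ⟦ b F.≟ c ⟧ + multiplicity v c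
multiplicity-∷ {L = L} b v c = ∑<-suc L (λ j → ⟦ lookup (b ∷ v) j F.≟ c ⟧)

fallingProduct : ∀ {k} → (Fin k → ℕ) → ∀ {L} → Vec (Fin k) L → ℕ
fallingProduct s [] = 1
fallingProduct s (b ∷ v) = (s b ∸ multiplicity v b) * fallingProduct s v

fallingProduct-! : ∀ {k L} (s : Fin k → ℕ) (v : Vec (Fin k) L) → (∀ c → multiplicity v c ≤ s c) →
  fallingProduct s v * ∏[ c < k ] ((s c ∸ multiplicity v c) !) ≡ ∏[ c < k ] ((s c) !)
fallingProduct-! s [] _ = +-identityʳ _
fallingProduct-! {k} s (b ∷ v) bounded = begin
  (s b ∸ multiplicity v b) * fallingProduct s v * ∏[ c < k ] ((s c ∸ multiplicity (b ∷ v) c) !)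
    ≡⟨ xy∙z≈y∙xz (s b ∸ multiplicity v b) _ _ ⟩
  fallingProduct s v * ((s b ∸ multiplicity v b) * ∏[ c < k ] ((s c ∸ multiplicity (b ∷ v) c) !))
    ≡⟨ cong (fallingProduct s v *_) (∏<-update k _ _ b (s b ∸ multiplicity v b) other at-b) ⟩
  fallingProduct s v * ∏[ c < k ] ((s c ∸ multiplicity v c) !)
    ≡⟨ fallingProduct-! s v (λ c → ≤-trans (m≤n+m _ _)
                                 (≤-trans (≤-reflexive (sym (multiplicity-∷ b v c))) (bounded c))) ⟩
  ∏[ c < k ] ((s c) !) ∎
  where
  open ≡-Reasoning
  other : ∀ c → c ≢ b → (s c ∸ multiplicity (b ∷ v) c) ! ≡ (s c ∸ multiplicity v c) !
  other c c≢b = cong (λ m → (s c ∸ m) !)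
    (trans (multiplicity-∷ b v c) (cong (_+ multiplicity v c) (⟦⟧-no (c≢b ∘ sym) (b F.≟ c))))
  self : multiplicity (b ∷ v) b ≡ suc (multiplicity v b)
  self = trans (multiplicity-∷ b v b) (cong (_+ multiplicity v b) (⟦⟧-yes refl (b F.≟ b)))
  a>0 : 0 < s b ∸ multiplicity v b
  a>0 = m<n⇒0<n∸m (≤-trans (≤-reflexive (sym self)) (bounded b))
  at-b : (s b ∸ multiplicity v b) * (s b ∸ multiplicity (b ∷ v) b) ! ≡ (s b ∸ multiplicity v b) !
  at-b = begin
    (s b ∸ multiplicity v b) * (s b ∸ multiplicity (b ∷ v) b) !
      ≡⟨ cong (λ m → (s b ∸ multiplicity v b) * m !)
              (trans (cong (s b ∸_) self) (sym (pred[m∸n]≡m∸[1+n] (s b) _))) ⟩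
    (s b ∸ multiplicity v b) * (pred (s b ∸ multiplicity v b)) !
      ≡⟨ n*[pred-n]!≡n! a>0 ⟩
    (s b ∸ multiplicity v b) ! ∎
    where
    n*[pred-n]!≡n! : ∀ {n} → 0 < n → n * (pred n) ! ≡ n !
    n*[pred-n]!≡n! {suc n} _ = refl

module InjectiveFillings {k} (m : ℕ) (In : Fin k → Fin m → Set) (In? : ∀ b x → Dec (In b x))
  (disjoint : ∀ b b′ x → In b x → In b′ x → b ≡ b′) where

  Fits : ∀ {L} → Vec (Fin m) L → Vec (Fin k) L → Set
  Fits σ bs = ∀ i → In (lookup bs i) (lookup σ i)

  fits? : ∀ {L} (σ : Vec (Fin m) L) (bs : Vec (Fin k) L) → Dec (Fits σ bs)
  fits? σ bs = FP.all? (λ i → In? (lookup bs i) (lookup σ i))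

  size : Fin k → ℕ
  size b = count (In? b)

  Fresh : ∀ {L} → Fin m → Vec (Fin m) L → Set
  Fresh x v = ∀ j → lookup v j ≢ x

  fresh? : ∀ {L} (x : Fin m) (v : Vec (Fin m) L) → Dec (Fresh x v)
  fresh? x v = FP.all? (λ j → ¬? (lookup v j F.≟ x))

  fresh-or-occurs : ∀ {L} (x : Fin m) (v : Vec (Fin m) L) → Distinct v →
    ⟦ fresh? x v ⟧ + count (λ j → lookup v j F.≟ x) ≡ 1
  fresh-or-occurs x v d with FP.any? (λ j → lookup v j F.≟ x)
  ... | yes (j , e) = cong₂ _+_ (⟦⟧-no (λ fresh → fresh j e) (fresh? x v))
    (≤-antisym (count-fibre≤1 (lookup v) d x)
               (≤-trans (≤-reflexive (sym (⟦⟧-yes e (lookup v j F.≟ x))))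
                        (term≤∑< _ (λ j → ⟦ lookup v j F.≟ x ⟧) j)))
  ... | no ¬occ = cong₂ _+_ (⟦⟧-yes (λ j e → ¬occ (j , e)) (fresh? x v))
    (∑-zero (allFin _) (λ j → ⟦⟧-no (λ e → ¬occ (j , e)) (lookup v j F.≟ x)))

  count-fresh : ∀ {L} (b : Fin k) (v : Vec (Fin m) L) (bs : Vec (Fin k) L) → Distinct v → Fits v bs →
    ∑[ x < m ] (⟦ In? b x ⟧ * ⟦ fresh? x v ⟧) ≡ size b ∸ multiplicity bs b
  count-fresh {L} b v bs d fits =
    trans (sym (m+n∸n≡m fresh (multiplicity bs b))) (cong (_∸ multiplicity bs b) fresh+occupied)
    where
    open ≡-Reasoning
    fresh = ∑[ x < m ] (⟦ In? b x ⟧ * ⟦ fresh? x v ⟧)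
    occurs : Fin m → ℕ
    occurs x = count (λ j → lookup v j F.≟ x)
    -- an entry of v lies in In b exactly when its label is b, by disjointness
    occupied : ∑[ x < m ] (⟦ In? b x ⟧ * occurs x) ≡ multiplicity bs b
    occupied = begin
      ∑[ x < m ] (⟦ In? b x ⟧ * occurs x)
        ≡⟨ ∑<-cong m (λ x → trans (sym (∑-*ˡ (allFin L) ⟦ In? b x ⟧ _))
                                  (∑<-cong L (λ j → *-comm ⟦ In? b x ⟧ _))) ⟩
      ∑[ x < m ] ∑[ j < L ] (⟦ lookup v j F.≟ x ⟧ * ⟦ In? b x ⟧)
        ≡⟨ ∑-comm (allFin m) (allFin L) _ ⟩
      ∑[ j < L ] ∑[ x < m ] (⟦ lookup v j F.≟ x ⟧ * ⟦ In? b x ⟧)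
        ≡⟨ ∑<-cong L (λ j → ∑<-δ m (lookup v j) (λ x → ⟦ In? b x ⟧)) ⟩
      ∑[ j < L ] ⟦ In? b (lookup v j) ⟧
        ≡⟨ count-cong (λ j → In? b (lookup v j)) (λ j → lookup bs j F.≟ b)
             (λ j → disjoint (lookup bs j) b (lookup v j) (fits j))
             (λ j e → subst (λ b′ → In b′ (lookup v j)) e (fits j)) ⟩
      multiplicity bs b ∎
    fresh+occupied : fresh + multiplicity bs b ≡ size b
    fresh+occupied = begin
      fresh + multiplicity bs b                                 ≡⟨ cong (fresh +_) (sym occupied) ⟩
      fresh + ∑[ x < m ] (⟦ In? b x ⟧ * occurs x)               ≡⟨ sym (∑-+ (allFin m) _ _) ⟩
      ∑[ x < m ] (⟦ In? b x ⟧ * ⟦ fresh? x v ⟧ + ⟦ In? b x ⟧ * occurs x)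
        ≡⟨ ∑<-cong m (λ x → sym (*-distribˡ-+ ⟦ In? b x ⟧ _ _)) ⟩
      ∑[ x < m ] (⟦ In? b x ⟧ * (⟦ fresh? x v ⟧ + occurs x))
        ≡⟨ ∑<-cong m (λ x → trans (cong (⟦ In? b x ⟧ *_) (fresh-or-occurs x v d)) (*-identityʳ _)) ⟩
      size b                                                    ∎

  count-fillings : ∀ L (bs : Vec (Fin k) L) →
    ∑[ σ ∈ allVecs m L ] (⟦ distinct? σ ⟧ * ⟦ fits? σ bs ⟧) ≡ fallingProduct size bs
  count-fillings zero [] = refl
  count-fillings (suc L) (b ∷ bs) = begin
    ∑[ σ ∈ allVecs m (suc L) ] (⟦ distinct? σ ⟧ * ⟦ fits? σ (b ∷ bs) ⟧)      ≡⟨ ∑-allVecs-suc m L _ ⟩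
    ∑[ x < m ] ∑[ v ∈ allVecs m L ] (⟦ distinct? (x ∷ v) ⟧ * ⟦ fits? (x ∷ v) (b ∷ bs) ⟧)
      ≡⟨ ∑<-cong m (λ x → ∑-cong (allVecs m L) (extend x)) ⟩
    ∑[ x < m ] ∑[ v ∈ allVecs m L ] (G v * (⟦ In? b x ⟧ * ⟦ fresh? x v ⟧))
      ≡⟨ ∑-comm (allFin m) (allVecs m L) _ ⟩
    ∑[ v ∈ allVecs m L ] ∑[ x < m ] (G v * (⟦ In? b x ⟧ * ⟦ fresh? x v ⟧))
      ≡⟨ ∑-cong (allVecs m L) (λ v → ∑-*ˡ (allFin m) (G v) _) ⟩
    ∑[ v ∈ allVecs m L ] (G v * ∑[ x < m ] (⟦ In? b x ⟧ * ⟦ fresh? x v ⟧))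
      ≡⟨ ∑-cong (allVecs m L) choices ⟩
    ∑[ v ∈ allVecs m L ] (G v * c)                                         ≡⟨ ∑-*ʳ (allVecs m L) c G ⟩
    ∑ (allVecs m L) G * c
      ≡⟨ cong (_* c) (count-fillings L bs) ⟩
    fallingProduct size bs * c
      ≡⟨ *-comm (fallingProduct size bs) c ⟩
    fallingProduct size (b ∷ bs)                                                      ∎
    where
    open ≡-Reasoning
    c = size b ∸ multiplicity bs b
    G : Vec (Fin m) L → ℕ
    G v = ⟦ distinct? v ⟧ * ⟦ fits? v bs ⟧
    choices : ∀ v → G v * ∑[ x < m ] (⟦ In? b x ⟧ * ⟦ fresh? x v ⟧) ≡ G v * c
    choices v with distinct? v | fits? v bs
    ... | yes d | yes f = cong (1 *_) (count-fresh b v bs d f)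
    ... | yes _ | no _ = refl
    ... | no _ | _ = refl
    extend : ∀ x v →
      ⟦ distinct? (x ∷ v) ⟧ * ⟦ fits? (x ∷ v) (b ∷ bs) ⟧ ≡ G v * (⟦ In? b x ⟧ * ⟦ fresh? x v ⟧)
    extend x v = begin
      ⟦ distinct? (x ∷ v) ⟧ * ⟦ fits? (x ∷ v) (b ∷ bs) ⟧
        ≡⟨ cong₂ _*_ distinct-∷ fits-∷ ⟩
      (⟦ fresh? x v ⟧ * ⟦ distinct? v ⟧) * (⟦ In? b x ⟧ * ⟦ fits? v bs ⟧)
        ≡⟨ rearrange ⟦ fresh? x v ⟧ ⟦ distinct? v ⟧ ⟦ In? b x ⟧ ⟦ fits? v bs ⟧ ⟩
      G v * (⟦ In? b x ⟧ * ⟦ fresh? x v ⟧)                                   ∎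
      where
      distinct-∷ : ⟦ distinct? (x ∷ v) ⟧ ≡ ⟦ fresh? x v ⟧ * ⟦ distinct? v ⟧
      distinct-∷ = trans (⟦⟧-cong (distinct-∷⁻ x v) (λ (fr , d) → distinct-∷⁺ x v fr d)
                                  (distinct? (x ∷ v)) (fresh? x v ×-dec distinct? v))
                         (⟦⟧-× (fresh? x v) (distinct? v) _)
      fits-∷ : ⟦ fits? (x ∷ v) (b ∷ bs) ⟧ ≡ ⟦ In? b x ⟧ * ⟦ fits? v bs ⟧
      fits-∷ = trans (⟦⟧-cong (λ f → f fz , f ∘ fs) (λ (i , f) → λ { fz → i ; (fs j) → f j })
                              (fits? (x ∷ v) (b ∷ bs)) (In? b x ×-dec fits? v bs))
                     (⟦⟧-× (In? b x) (fits? v bs) _)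
      rearrange : ∀ a b c d → (a * b) * (c * d) ≡ (b * d) * (c * a)
      rearrange = solve-∀

WeaklyIncreasing : ∀ {k n} → Vec (Fin k) n → Set
WeaklyIncreasing {n = n} w = ∀ (i j : Fin n) → toℕ i < toℕ j → toℕ (lookup w i) ≤ toℕ (lookup w j)

weaklyIncreasing? : ∀ {k n} (w : Vec (Fin k) n) → Dec (WeaklyIncreasing w)
weaklyIncreasing? w = FP.all? λ i → FP.all? λ j →
  (toℕ i <? toℕ j) →-dec (toℕ (lookup w i) ≤? toℕ (lookup w j))

Av≡∑∑ : ∀ Υ n k →
  Av Υ n k ≡ ∑[ w ∈ allVecs k n ] ∑[ σ ∈ allVecs n n ] (⟦ isPerm? σ ⟧ * ⟦ biAvoids? Υ (σ , w) ⟧)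
Av≡∑∑ Υ n k = begin
  Av Υ n k
    ≡⟨ length-filter (biAvoids? Υ) (colPerms n k) ⟩
  ∑[ x ∈ colPerms n k ] ⟦ biAvoids? Υ x ⟧
    ≡⟨ ∑-cartesianProduct (perms n) (allVecs k n) _ ⟩
  ∑[ σ ∈ perms n ] ∑[ w ∈ allVecs k n ] ⟦ biAvoids? Υ (σ , w) ⟧
    ≡⟨ ∑-filter isPerm? (allVecs n n) _ ⟩
  ∑[ σ ∈ allVecs n n ] (⟦ isPerm? σ ⟧ * ∑[ w ∈ allVecs k n ] ⟦ biAvoids? Υ (σ , w) ⟧)
    ≡⟨ ∑-cong (allVecs n n) (λ σ → sym (∑-*ˡ (allVecs k n) ⟦ isPerm? σ ⟧ _)) ⟩
  ∑[ σ ∈ allVecs n n ] ∑[ w ∈ allVecs k n ] (⟦ isPerm? σ ⟧ * ⟦ biAvoids? Υ (σ , w) ⟧)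
    ≡⟨ ∑-comm (allVecs n n) (allVecs k n) _ ⟩
  ∑[ w ∈ allVecs k n ] ∑[ σ ∈ allVecs n n ] (⟦ isPerm? σ ⟧ * ⟦ biAvoids? Υ (σ , w) ⟧) ∎
  where open ≡-Reasoning

perm∧avoids-indicator : ∀ {n} (σ : Vec (Fin n) n) {A W X : Set} (a? : Dec A) (w? : Dec W) (x? : Dec X) →
  (Distinct σ → A → W × X) → (W → X → A) →
  ⟦ isPerm? σ ⟧ * ⟦ a? ⟧ ≡ ⟦ w? ⟧ * (⟦ distinct? σ ⟧ * ⟦ x? ⟧)
perm∧avoids-indicator σ a? w? x? to from with distinct? σ
... | no ¬d = trans (cong (_* ⟦ a? ⟧) (⟦⟧-no (¬d ∘ Unique⇒Distinct σ) (isPerm? σ))) (sym (*-zeroʳ ⟦ w? ⟧))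
... | yes d = begin
  ⟦ isPerm? σ ⟧ * ⟦ a? ⟧
    ≡⟨ cong₂ _*_ (⟦⟧-yes (Distinct⇒Unique σ d) (isPerm? σ))
                 (⟦⟧-cong (to d) (λ (w , x) → from w x) a? (w? ×-dec x?)) ⟩
  1 * ⟦ w? ×-dec x? ⟧         ≡⟨ *-identityˡ _ ⟩
  ⟦ w? ×-dec x? ⟧             ≡⟨ ⟦⟧-× w? x? _ ⟩
  ⟦ w? ⟧ * ⟦ x? ⟧             ≡⟨ cong (⟦ w? ⟧ *_) (sym (*-identityˡ _)) ⟩
  ⟦ w? ⟧ * (1 * ⟦ x? ⟧)       ∎
  where open ≡-Reasoning

module Colouring {n k} (w : Vec (Fin k) n) where

  colour : Fin n → ℕ
  colour i = toℕ (lookup w i)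

  smaller larger : Fin k → ℕ
  smaller c = count (λ l → colour l <? toℕ c)
  larger c = count (λ l → toℕ c <? colour l)

  partition : ∀ c → smaller c + multiplicity w c + larger c ≡ n
  partition c = begin
    smaller c + multiplicity w c + larger c
      ≡⟨ sym (trans (∑-+ (allFin n) _ _) (cong (_+ larger c) (∑-+ (allFin n) _ _))) ⟩
    ∑[ l < n ] (⟦ colour l <? toℕ c ⟧ + ⟦ lookup w l F.≟ c ⟧ + ⟦ toℕ c <? colour l ⟧)
      ≡⟨ ∑<-cong n (λ l → ⟦⟧-trichotomy (λ l<c l≡c → <-irrefl (cong toℕ l≡c) l<c) <-asym
                                        (λ { refl c<l → <-irrefl refl c<l }) (same l)
                                        (colour l <? toℕ c) (lookup w l F.≟ c) (toℕ c <? colour l)) ⟩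
    ∑[ _ < n ] 1 ≡⟨ ∑<-1 n ⟩
    n ∎
    where
    open ≡-Reasoning
    same : ∀ l → colour l ≮ toℕ c → lookup w l ≢ c → toℕ c < colour l
    same l l≮c l≢c = ≤∧≢⇒< (≮⇒≥ l≮c) (λ c≡l → l≢c (FP.toℕ-injective (sym c≡l)))

  -- the values taken by σ on colour c: larger colours get smaller values
  Block : Fin k → Fin n → Set
  Block c x = larger c ≤ toℕ x × toℕ x < n ∸ smaller c

  block? : ∀ c x → Dec (Block c x)
  block? c x = (larger c ≤? toℕ x) ×-dec (toℕ x <? n ∸ smaller c)

  block-size : ∀ c → count (block? c) ≡ multiplicity w c
  block-size c = begin
    count (block? c)
      ≡⟨ count-interval n (larger c) (n ∸ smaller c) (m∸n≤m n (smaller c)) ⟩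
    n ∸ smaller c ∸ larger c
      ≡⟨ cong (λ m → m ∸ smaller c ∸ larger c) (sym (partition c)) ⟩
    smaller c + multiplicity w c + larger c ∸ smaller c ∸ larger c
      ≡⟨ cong (_∸ larger c) (trans (cong (_∸ smaller c) (+-assoc (smaller c) _ _)) (m+n∸m≡n (smaller c) _)) ⟩
    multiplicity w c + larger c ∸ larger c                   ≡⟨ m+n∸n≡m (multiplicity w c) (larger c) ⟩
    multiplicity w c                                         ∎
    where open ≡-Reasoning

  blocks-ordered : ∀ c d → toℕ c < toℕ d → n ∸ smaller d ≤ larger c
  blocks-ordered c d c<d = ≤-trans (∸-monoˡ-≤ (smaller d) covered) (≤-reflexive (m+n∸m≡n (smaller d) (larger c)))
    where
    open ≤-Reasoning
    covered : n ≤ smaller d + larger c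
    covered = begin
      n                                                ≡⟨ sym (∑<-1 n) ⟩
      ∑[ _ < n ] 1
        ≤⟨ ∑-mono (allFin n) (λ l → ⟦⟧-cover (λ l≮d → <-≤-trans c<d (≮⇒≥ l≮d)) (colour l <? toℕ d) (toℕ c <? colour l)) ⟩
      ∑[ l < n ] (⟦ colour l <? toℕ d ⟧ + ⟦ toℕ c <? colour l ⟧) ≡⟨ ∑-+ (allFin n) _ _ ⟩
      smaller d + larger c                             ∎

  blocks-disjoint : ∀ c d x → Block c x → Block d x → c ≡ d
  blocks-disjoint c d x (c≤x , x<c) (d≤x , x<d) with <-cmp (toℕ c) (toℕ d)
  ... | tri< c<d _ _ = contradiction (<-≤-trans x<d (≤-trans (blocks-ordered c d c<d) c≤x)) (<-irrefl refl)
  ... | tri≈ _ c≡d _ = FP.toℕ-injective c≡d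
  ... | tri> _ _ d<c = contradiction (<-≤-trans x<c (≤-trans (blocks-ordered d c d<c) d≤x)) (<-irrefl refl)

  smaller≡∑multiplicity : ∀ c → smaller c ≡ ∑[ d < k ] (multiplicity w d * ⟦ toℕ d <? toℕ c ⟧)
  smaller≡∑multiplicity c = begin
    smaller c
      ≡⟨ ∑<-cong n (λ l → sym (∑<-δ k (lookup w l) _)) ⟩
    ∑[ l < n ] ∑[ d < k ] (⟦ lookup w l F.≟ d ⟧ * ⟦ toℕ d <? toℕ c ⟧)
      ≡⟨ ∑-comm (allFin n) (allFin k) _ ⟩
    ∑[ d < k ] ∑[ l < n ] (⟦ lookup w l F.≟ d ⟧ * ⟦ toℕ d <? toℕ c ⟧)
      ≡⟨ ∑<-cong k (λ d → ∑-*ʳ (allFin n) _ _) ⟩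
    ∑[ d < k ] (multiplicity w d * ⟦ toℕ d <? toℕ c ⟧)                ∎
    where open ≡-Reasoning

  module _ (wi : WeaklyIncreasing w) where

    position<smaller : ∀ i c → colour i < toℕ c → suc (toℕ i) ≤ smaller c
    position<smaller i c ci<c = begin
      suc (toℕ i)                           ≡⟨ sym (count-toℕ< n (suc (toℕ i)) (FP.toℕ<n i)) ⟩
      count (λ (l : Fin n) → toℕ l <? suc (toℕ i))
        ≤⟨ count-mono (λ (l : Fin n) → toℕ l <? suc (toℕ i)) (λ l → colour l <? toℕ c) up-to-i ⟩
      smaller c                             ∎
      where
      open ≤-Reasoning
      up-to-i : ∀ l → toℕ l < suc (toℕ i) → colour l < toℕ c
      up-to-i l l≤i with m≤n⇒m<n∨m≡n (s≤s⁻¹ l≤i)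
      ... | inj₁ l<i = ≤-<-trans (wi l i l<i) ci<c
      ... | inj₂ l≡i = subst (λ j → colour j < toℕ c) (sym (FP.toℕ-injective l≡i)) ci<c

    smaller≤position : ∀ i c → toℕ c ≤ colour i → smaller c ≤ toℕ i
    smaller≤position i c c≤ci = begin
      smaller c
        ≤⟨ count-mono (λ (l : Fin n) → colour l <? toℕ c) (λ l → toℕ l <? toℕ i) before-i ⟩
      count (λ (l : Fin n) → toℕ l <? toℕ i) ≡⟨ count-toℕ< n (toℕ i) (<⇒≤ (FP.toℕ<n i)) ⟩
      toℕ i                        ∎
      where
      open ≤-Reasoning
      before-i : ∀ l → colour l < toℕ c → toℕ l < toℕ i
      before-i l cl<c = ≰⇒> λ i≤l → <⇒≱ cl<c (≤-trans c≤ci (at-most i≤l))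
        where
        at-most : toℕ i ≤ toℕ l → colour i ≤ colour l
        at-most i≤l with m≤n⇒m<n∨m≡n i≤l
        ... | inj₁ i<l = wi i l i<l
        ... | inj₂ i≡l = ≤-reflexive (cong (toℕ ∘ lookup w) (FP.toℕ-injective i≡l))

  open InjectiveFillings n Block block? blocks-disjoint using (Fits; fits?; size; count-fillings)

  fallingProduct≡∏! : fallingProduct size w ≡ ∏[ c < k ] (multiplicity w c !)
  fallingProduct≡∏! = begin
    fallingProduct size w                                          ≡⟨ sym (*-identityʳ _) ⟩
    fallingProduct size w * 1
      ≡⟨ cong (fallingProduct size w *_) (sym none-left) ⟩
    fallingProduct size w * ∏[ c < k ] ((size c ∸ multiplicity w c) !)
      ≡⟨ fallingProduct-! size w (λ c → ≤-reflexive (sym (block-size c))) ⟩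
    ∏[ c < k ] (size c !)
      ≡⟨ ∏<-cong k (λ c → cong _! (block-size c)) ⟩
    ∏[ c < k ] (multiplicity w c !)                                ∎
    where
    open ≡-Reasoning
    none-left : ∏[ c < k ] ((size c ∸ multiplicity w c) !) ≡ 1
    none-left = trans (∏<-cong k (λ c → trans (cong (λ m → (m ∸ multiplicity w c) !) (block-size c))
                                              (cong _! (n∸n≡0 (multiplicity w c)))))
                      (∏<-1 k)

  -- the Υ₂-avoider with colouring w is the rank function of this order
  _≺_ : Fin n → Fin n → Set
  l ≺ i = colour i < colour l ⊎ (colour l ≡ colour i × toℕ l < toℕ i)

  ≺-trans : ∀ {i j l} → i ≺ j → j ≺ l → i ≺ l
  ≺-trans (inj₁ cj<ci) (inj₁ cl<cj) = inj₁ (<-trans cl<cj cj<ci)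
  ≺-trans (inj₁ cj<ci) (inj₂ (cj≡cl , _)) = inj₁ (subst (_< _) cj≡cl cj<ci)
  ≺-trans (inj₂ (ci≡cj , _)) (inj₁ cl<cj) = inj₁ (subst (_ <_) (sym ci≡cj) cl<cj)
  ≺-trans (inj₂ (ci≡cj , i<j)) (inj₂ (cj≡cl , j<l)) = inj₂ (trans ci≡cj cj≡cl , <-trans i<j j<l)

  ≺-compare : Trichotomous _≡_ _≺_
  ≺-compare i j with <-cmp (colour j) (colour i)
  ... | tri< cj<ci _ _ = tri< (inj₁ cj<ci) (λ { refl → <-irrefl refl cj<ci })
                              λ { (inj₁ ci<cj) → <-asym cj<ci ci<cj ; (inj₂ (cj≡ci , _)) → <-irrefl cj≡ci cj<ci }
  ... | tri> _ _ ci<cj = tri> (λ { (inj₁ cj<ci) → <-asym cj<ci ci<cj ; (inj₂ (ci≡cj , _)) → <-irrefl ci≡cj ci<cj })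
                              (λ { refl → <-irrefl refl ci<cj }) (inj₁ ci<cj)
  ... | tri≈ _ cj≡ci _ with <-cmp (toℕ i) (toℕ j)
  ...   | tri< i<j _ _ = tri< (inj₂ (sym cj≡ci , i<j)) (λ { refl → <-irrefl refl i<j })
                              λ { (inj₁ ci<cj) → <-irrefl (sym cj≡ci) ci<cj ; (inj₂ (_ , j<i)) → <-asym i<j j<i }
  ...   | tri≈ _ i≡j _ = tri≈ (λ { (inj₁ cj<ci) → <-irrefl cj≡ci cj<ci ; (inj₂ (_ , i<j)) → <-irrefl i≡j i<j })
                              (FP.toℕ-injective i≡j)
                              (λ { (inj₁ ci<cj) → <-irrefl (sym cj≡ci) ci<cj ; (inj₂ (_ , j<i)) → <-irrefl (sym i≡j) j<i })
  ...   | tri> _ _ j<i = tri> (λ { (inj₁ cj<ci) → <-irrefl cj≡ci cj<ci ; (inj₂ (_ , i<j)) → <-asym i<j j<i })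
                              (λ { refl → <-irrefl refl j<i }) (inj₂ (cj≡ci , j<i))

  open Rank _≺_ ≺-trans ≺-compare using (rank; rank<n; rank-mono; rank-injective; monotone⇒rank)

  ranks : Vec (Fin n) n
  ranks = V.tabulate (λ i → fromℕ< (rank<n i))

  toℕ-ranks : ∀ i → toℕ (lookup ranks i) ≡ rank i
  toℕ-ranks i = trans (cong toℕ (VP.lookup∘tabulate _ i)) (FP.toℕ-fromℕ< (rank<n i))

  ranks-distinct : Distinct ranks
  ranks-distinct i j e = rank-injective i j (trans (sym (toℕ-ranks i)) (trans (cong toℕ e) (toℕ-ranks j)))

  module Avoidance (σ : Vec (Fin n) n) where

    value : Fin n → ℕ
    value i = toℕ (lookup σ i)

    Layered : Set
    Layered = ∀ i l → colour i < colour l → value l < value i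

    Monotone : Set
    Monotone = ∀ l i → l ≺ i → value l < value i

    values-differ : Distinct σ → ∀ i j → toℕ i < toℕ j → value i ≢ value j
    values-differ d i j i<j e = <-irrefl (cong toℕ (d i j (FP.toℕ-injective e))) i<j

    avoids⇒weaklyIncreasing : Distinct σ → ¬ BiOccurs (t12 , u10) (σ , w) → ¬ BiOccurs (t21 , u10) (σ , w) →
      WeaklyIncreasing w
    avoids⇒weaklyIncreasing d no12 no21 i j i<j = ≮⇒≥ λ cj<ci → by-values (<-cmp (value i) (value j)) cj<ci
      where
      by-values : Tri (value i < value j) (value i ≡ value j) (value j < value i) → colour j < colour i → ⊥
      by-values (tri< vi<vj _ _) cj<ci = no12 (i , j , i<j , vi<vj , cj<ci)
      by-values (tri≈ _ vi≡vj _) _ = values-differ d i j i<j vi≡vj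
      by-values (tri> _ _ vj<vi) cj<ci = no21 (i , j , i<j , vj<vi , cj<ci)

    avoids⇒layered : Distinct σ → WeaklyIncreasing w → ¬ BiOccurs (t12 , u01) (σ , w) → Layered
    avoids⇒layered d wi no12 i l ci<cl with <-cmp (toℕ i) (toℕ l)
    ... | tri≈ _ i≡l _ = contradiction (cong (toℕ ∘ lookup w) (FP.toℕ-injective i≡l)) (<⇒≢ ci<cl)
    ... | tri> _ _ l<i = contradiction (wi l i l<i) (<⇒≱ ci<cl)
    ... | tri< i<l _ _ with <-cmp (value i) (value l)
    ...   | tri< vi<vl _ _ = contradiction (i , l , i<l , vi<vl , ci<cl) no12
    ...   | tri≈ _ vi≡vl _ = contradiction vi≡vl (values-differ d i l i<l)
    ...   | tri> _ _ vl<vi = vl<vi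

    layered⇒fits : Distinct σ → Layered → Fits σ w
    layered⇒fits d layered i = lower , upper
      where
      vi<n : value i < n
      vi<n = FP.toℕ<n (lookup σ i)
      lower : larger (lookup w i) ≤ value i
      lower = count≤value (lookup σ) d (λ l → colour i <? colour l) (value i) (<⇒≤ vi<n) (layered i)
      above : smaller (lookup w i) ≤ n ∸ suc (value i)
      above = count≤room-above (lookup σ) d (λ l → colour l <? colour i) (value i) vi<n (λ l cl<ci → layered l i cl<ci)
      upper : value i < n ∸ smaller (lookup w i)
      upper = m+n≤o⇒m≤o∸n (suc (value i))
                (≤-trans (≤-reflexive (+-comm (suc (value i)) _)) (m≤o∸n⇒m+n≤o _ vi<n above))

    fits⇒layered : Fits σ w → Layered
    fits⇒layered fits i l ci<cl = begin-strict
      value l                        <⟨ proj₂ (fits l) ⟩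
      n ∸ smaller (lookup w l)       ≤⟨ blocks-ordered (lookup w i) (lookup w l) ci<cl ⟩
      larger (lookup w i)            ≤⟨ proj₁ (fits i) ⟩
      value i                        ∎
      where open ≤-Reasoning

    layered⇒avoids₁ : WeaklyIncreasing w → Layered → BiAvoids Υ₁ (σ , w)
    layered⇒avoids₁ wi layered =
        (λ (i , j , _ , vi<vj , ci<cj) → <-asym vi<vj (layered i j ci<cj))
      , (λ (i , j , i<j , _ , cj<ci) → <⇒≱ cj<ci (wi i j i<j))
      , (λ (i , j , i<j , _ , cj<ci) → <⇒≱ cj<ci (wi i j i<j))
      , tt

    avoids₁⇒ : Distinct σ → BiAvoids Υ₁ (σ , w) → WeaklyIncreasing w × Fits σ w
    avoids₁⇒ d (no12₀₁ , no12₁₀ , no21₁₀ , _) =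
      wi , layered⇒fits d (avoids⇒layered d wi no12₀₁)
      where wi = avoids⇒weaklyIncreasing d no12₁₀ no21₁₀

    avoids₁⇐ : WeaklyIncreasing w → Fits σ w → BiAvoids Υ₁ (σ , w)
    avoids₁⇐ wi fits = layered⇒avoids₁ wi (fits⇒layered fits)

    avoids₂⇒monotone : Distinct σ → WeaklyIncreasing w → ¬ BiOccurs (t12 , u01) (σ , w) →
      ¬ BiOccurs (t21 , u00) (σ , w) → Monotone
    avoids₂⇒monotone d wi no12 no21 l i (inj₁ ci<cl) = avoids⇒layered d wi no12 i l ci<cl
    avoids₂⇒monotone d wi no12 no21 l i (inj₂ (cl≡ci , l<i)) with <-cmp (value l) (value i)
    ... | tri< vl<vi _ _ = vl<vi
    ... | tri≈ _ vl≡vi _ = contradiction vl≡vi (values-differ d l i l<i)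
    ... | tri> _ _ vi<vl = contradiction (l , i , l<i , vi<vl , cl≡ci) no21

    monotone⇒ranks : Distinct σ → Monotone → ranks ≡ σ
    monotone⇒ranks d mono = trans (VP.tabulate-cong same) (VP.tabulate∘lookup σ)
      where
      same : ∀ i → fromℕ< (rank<n i) ≡ lookup σ i
      same i = FP.toℕ-injective (trans (FP.toℕ-fromℕ< (rank<n i)) (sym (monotone⇒rank (lookup σ) d mono i)))

    ranks⇒monotone : ranks ≡ σ → Monotone
    ranks⇒monotone refl l i l≺i =
      subst₂ _<_ (sym (toℕ-ranks l)) (sym (toℕ-ranks i)) (rank-mono l≺i)

    avoids₂⇒ : Distinct σ → BiAvoids Υ₂ (σ , w) → WeaklyIncreasing w × ranks ≡ σ
    avoids₂⇒ d (no12₀₁ , no12₁₀ , no21₁₀ , no21₀₀ , _) =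
      wi , monotone⇒ranks d (avoids₂⇒monotone d wi no12₀₁ no21₀₀)
      where wi = avoids⇒weaklyIncreasing d no12₁₀ no21₁₀

    avoids₂⇐ : WeaklyIncreasing w → ranks ≡ σ → BiAvoids Υ₂ (σ , w)
    avoids₂⇐ wi ranks≡σ =
      let (no12₀₁ , no12₁₀ , no21₁₀ , _) = layered⇒avoids₁ wi (λ i l ci<cl → mono l i (inj₁ ci<cl))
      in no12₀₁ , no12₁₀ , no21₁₀
       , (λ (i , j , i<j , vj<vi , ci≡cj) → <-asym vj<vi (mono i j (inj₂ (ci≡cj , i<j))))
       , tt
      where mono = ranks⇒monotone ranks≡σ

  open Avoidance

  avoiders₁ : ∑[ σ ∈ allVecs n n ] (⟦ isPerm? σ ⟧ * ⟦ biAvoids? Υ₁ (σ , w) ⟧)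
            ≡ ⟦ weaklyIncreasing? w ⟧ * ∏[ c < k ] (multiplicity w c !)
  avoiders₁ = begin
    ∑[ σ ∈ allVecs n n ] (⟦ isPerm? σ ⟧ * ⟦ biAvoids? Υ₁ (σ , w) ⟧)
      ≡⟨ ∑-cong (allVecs n n) (λ σ → perm∧avoids-indicator σ (biAvoids? Υ₁ (σ , w)) (weaklyIncreasing? w) (fits? σ w)
                                                          (avoids₁⇒ σ) (avoids₁⇐ σ)) ⟩
    ∑[ σ ∈ allVecs n n ] (⟦ weaklyIncreasing? w ⟧ * (⟦ distinct? σ ⟧ * ⟦ fits? σ w ⟧))
      ≡⟨ ∑-*ˡ (allVecs n n) ⟦ weaklyIncreasing? w ⟧ _ ⟩
    ⟦ weaklyIncreasing? w ⟧ * ∑[ σ ∈ allVecs n n ] (⟦ distinct? σ ⟧ * ⟦ fits? σ w ⟧)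
      ≡⟨ cong (⟦ weaklyIncreasing? w ⟧ *_) (trans (count-fillings n w) fallingProduct≡∏!) ⟩
    ⟦ weaklyIncreasing? w ⟧ * ∏[ c < k ] (multiplicity w c !) ∎
    where open ≡-Reasoning

  avoiders₂ : ∑[ σ ∈ allVecs n n ] (⟦ isPerm? σ ⟧ * ⟦ biAvoids? Υ₂ (σ , w) ⟧) ≡ ⟦ weaklyIncreasing? w ⟧
  avoiders₂ = begin
    ∑[ σ ∈ allVecs n n ] (⟦ isPerm? σ ⟧ * ⟦ biAvoids? Υ₂ (σ , w) ⟧)
      ≡⟨ ∑-cong (allVecs n n) (λ σ → perm∧avoids-indicator σ (biAvoids? Υ₂ (σ , w)) (weaklyIncreasing? w) (ranks ≟ᵛ σ)
                                                          (avoids₂⇒ σ) (avoids₂⇐ σ)) ⟩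
    ∑[ σ ∈ allVecs n n ] (⟦ weaklyIncreasing? w ⟧ * (⟦ distinct? σ ⟧ * ⟦ ranks ≟ᵛ σ ⟧))
      ≡⟨ ∑-*ˡ (allVecs n n) ⟦ weaklyIncreasing? w ⟧ _ ⟩
    ⟦ weaklyIncreasing? w ⟧ * ∑[ σ ∈ allVecs n n ] (⟦ distinct? σ ⟧ * ⟦ ranks ≟ᵛ σ ⟧)
      ≡⟨ cong (⟦ weaklyIncreasing? w ⟧ *_) (trans (∑-cong (allVecs n n) (λ σ → *-comm ⟦ distinct? σ ⟧ _))
                                                  (∑-allVecs-δ n n ranks (λ σ → ⟦ distinct? σ ⟧))) ⟩
    ⟦ weaklyIncreasing? w ⟧ * ⟦ distinct? ranks ⟧
      ≡⟨ cong (⟦ weaklyIncreasing? w ⟧ *_) (⟦⟧-yes ranks-distinct (distinct? ranks)) ⟩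
    ⟦ weaklyIncreasing? w ⟧ * 1                   ≡⟨ *-identityʳ _ ⟩
    ⟦ weaklyIncreasing? w ⟧ ∎
    where
    open ≡-Reasoning

occurs⇒multiplicity>0 : ∀ {k n} (v : Vec (Fin k) n) j → 0 < multiplicity v (lookup v j)
occurs⇒multiplicity>0 {n = n} v j =
  ≤-trans (≤-reflexive (sym (⟦⟧-yes refl (lookup v j F.≟ lookup v j))))
          (term≤∑< n (λ l → ⟦ lookup v l F.≟ lookup v j ⟧) j)

∑-multiplicity : ∀ {k n} (w : Vec (Fin k) n) → ∑[ c < k ] multiplicity w c ≡ n
∑-multiplicity {k} {n} w = begin
  ∑[ c < k ] ∑[ l < n ] ⟦ lookup w l F.≟ c ⟧ ≡⟨ ∑-comm (allFin k) (allFin n) _ ⟩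
  ∑[ l < n ] ∑[ c < k ] ⟦ lookup w l F.≟ c ⟧
    ≡⟨ ∑<-cong n (λ l → count-≟ k (lookup w l)) ⟩
  ∑[ _ < n ] 1                              ≡⟨ ∑<-1 n ⟩
  n                                         ∎
  where open ≡-Reasoning

weaklyIncreasing-unique : ∀ {k n} (w w′ : Vec (Fin k) n) → WeaklyIncreasing w → WeaklyIncreasing w′ →
  (∀ c → multiplicity w c ≡ multiplicity w′ c) → w ≡ w′
weaklyIncreasing-unique {k} w w′ wi wi′ same =
  trans (sym (VP.tabulate∘lookup w)) (trans (VP.tabulate-cong pointwise) (VP.tabulate∘lookup w′))
  where
  module C = Colouring w
  module C′ = Colouring w′
  same-smaller : ∀ c → C.smaller c ≡ C′.smaller c
  same-smaller c = trans (C.smaller≡∑multiplicity c)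
    (trans (∑<-cong k (λ d → cong (_* ⟦ toℕ d <? toℕ c ⟧) (same d))) (sym (C′.smaller≡∑multiplicity c)))
  -- a weakly increasing word has its i-th letter c exactly when smaller c ≤ i < smaller (c + 1)
  pointwise : ∀ i → lookup w i ≡ lookup w′ i
  pointwise i with <-cmp (C.colour i) (C′.colour i)
  ... | tri≈ _ e _ = FP.toℕ-injective e
  ... | tri< ci<c′i _ _ = contradiction (C′.smaller≤position wi′ i (lookup w′ i) ≤-refl)
    (<⇒≱ (≤-trans (C.position<smaller wi i (lookup w′ i) ci<c′i) (≤-reflexive (same-smaller (lookup w′ i)))))
  ... | tri> _ _ c′i<ci = contradiction (C.smaller≤position wi i (lookup w i) ≤-refl)
    (<⇒≱ (≤-trans (C′.position<smaller wi′ i (lookup w i) c′i<ci) (≤-reflexive (sym (same-smaller (lookup w i))))))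

least-nonzero : ∀ k (A : Fin k → ℕ) → 0 < ∑< k A → ∃ λ c → 0 < A c × (∀ d → toℕ d < toℕ c → A d ≡ 0)
least-nonzero (suc k) A pos with 0 <? A fz
... | yes A0>0 = fz , A0>0 , (λ _ ())
... | no A0≯0 = fs c , Ac>0 , earlier
  where
  A0≡0 : A fz ≡ 0
  A0≡0 = n≤0⇒n≡0 (≮⇒≥ A0≯0)
  rest = least-nonzero k (A ∘ fs) (<-≤-trans pos (≤-reflexive (trans (∑<-suc k A) (cong (_+ ∑< k (A ∘ fs)) A0≡0))))
  c = proj₁ rest
  Ac>0 = proj₁ (proj₂ rest)
  earlier : ∀ d → toℕ d < toℕ (fs c) → A d ≡ 0
  earlier fz _ = A0≡0
  earlier (fs d) d<c = proj₂ (proj₂ rest) d (s≤s⁻¹ d<c)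

-- the word lists its least letter first, then recurses on the remaining multiplicities
weaklyIncreasing-exists : ∀ {k} n (A : Fin k → ℕ) → ∑< k A ≡ n →
  ∃ λ (w : Vec (Fin k) n) → WeaklyIncreasing w × (∀ c → multiplicity w c ≡ A c)
weaklyIncreasing-exists {k} zero A ∑A≡0 =
  [] , (λ ()) , (λ c → sym (n≤0⇒n≡0 (≤-trans (term≤∑< k A c) (≤-reflexive ∑A≡0))))
weaklyIncreasing-exists {k} (suc n) A ∑A≡1+n = c ∷ v , wi , mult
  where
  least = least-nonzero k A (≤-trans (s≤s z≤n) (≤-reflexive (sym ∑A≡1+n)))
  c = proj₁ least
  Ac>0 = proj₁ (proj₂ least)
  A′ : Fin k → ℕ
  A′ d = A d ∸ ⟦ c F.≟ d ⟧
  A≡A′+δ : ∀ d → A d ≡ A′ d + ⟦ c F.≟ d ⟧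
  A≡A′+δ d with c F.≟ d
  ... | yes refl = sym (m∸n+n≡m Ac>0)
  ... | no _ = sym (+-identityʳ (A d))
  ∑A′≡n : ∑< k A′ ≡ n
  ∑A′≡n = suc-injective (begin
    suc (∑< k A′)                            ≡⟨ +-comm 1 (∑< k A′) ⟩
    ∑< k A′ + 1
      ≡⟨ cong (∑< k A′ +_) (sym (count-≟ k c)) ⟩
    ∑< k A′ + ∑[ d < k ] ⟦ c F.≟ d ⟧         ≡⟨ sym (∑-+ (allFin k) A′ _) ⟩
    ∑[ d < k ] (A′ d + ⟦ c F.≟ d ⟧)          ≡⟨ ∑<-cong k (λ d → sym (A≡A′+δ d)) ⟩
    ∑< k A                                   ≡⟨ ∑A≡1+n ⟩
    suc n                                    ∎)
    where open ≡-Reasoning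
  rest = weaklyIncreasing-exists n A′ ∑A′≡n
  v = proj₁ rest
  wi′ = proj₁ (proj₂ rest)
  mult′ = proj₂ (proj₂ rest)
  mult : ∀ d → multiplicity (c ∷ v) d ≡ A d
  mult d = begin
    multiplicity (c ∷ v) d          ≡⟨ multiplicity-∷ c v d ⟩
    ⟦ c F.≟ d ⟧ + multiplicity v d  ≡⟨ cong (⟦ c F.≟ d ⟧ +_) (mult′ d) ⟩
    ⟦ c F.≟ d ⟧ + A′ d              ≡⟨ +-comm _ (A′ d) ⟩
    A′ d + ⟦ c F.≟ d ⟧              ≡⟨ sym (A≡A′+δ d) ⟩
    A d                             ∎
    where open ≡-Reasoning
  c≤v : ∀ j → toℕ c ≤ toℕ (lookup v j)
  c≤v j = ≮⇒≥ λ vj<c → <⇒≢ (occurs⇒multiplicity>0 v j) (sym (begin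
    multiplicity v (lookup v j)            ≡⟨ mult′ (lookup v j) ⟩
    A (lookup v j) ∸ ⟦ c F.≟ lookup v j ⟧  ≡⟨ cong (_∸ ⟦ c F.≟ lookup v j ⟧) (proj₂ (proj₂ least) _ vj<c) ⟩
    0 ∸ ⟦ c F.≟ lookup v j ⟧               ≡⟨ 0∸n≡0 ⟦ c F.≟ lookup v j ⟧ ⟩
    0                                      ∎))
    where open ≡-Reasoning
  wi : WeaklyIncreasing (c ∷ v)
  wi fz (fs j) _ = c≤v j
  wi (fs i) (fs j) i<j = wi′ i j (s≤s⁻¹ i<j)

∑-reindex : ∀ {A B : Set} (xs : List A) (ys : List B) {P : A → Set} {Q : B → Set}
  (P? : ∀ x → Dec (P x)) (Q? : ∀ y → Dec (Q y)) (_≟_ : DecidableEquality B) (f : A → B) (g : B → ℕ) →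
  (∀ x → P x → Q (f x)) →
  (∀ y → Q y → ∑[ x ∈ xs ] (⟦ P? x ⟧ * ⟦ f x ≟ y ⟧) ≡ 1) →
  (∀ (h : B → ℕ) x → ∑[ y ∈ ys ] (⟦ f x ≟ y ⟧ * h y) ≡ h (f x)) →
  ∑[ x ∈ xs ] (⟦ P? x ⟧ * g (f x)) ≡ ∑[ y ∈ ys ] (⟦ Q? y ⟧ * g y)
∑-reindex xs ys {P} {Q} P? Q? _≟_ f g maps-into one-preimage ys-select = sym (begin
  ∑[ y ∈ ys ] (⟦ Q? y ⟧ * g y)                                         ≡⟨ ∑-cong ys (λ y → weight y (Q? y)) ⟩
  ∑[ y ∈ ys ] (⟦ Q? y ⟧ * g y * ∑[ x ∈ xs ] (⟦ P? x ⟧ * ⟦ f x ≟ y ⟧))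
    ≡⟨ ∑-cong ys (λ y → sym (∑-*ˡ xs (⟦ Q? y ⟧ * g y) (λ x → ⟦ P? x ⟧ * ⟦ f x ≟ y ⟧))) ⟩
  ∑[ y ∈ ys ] ∑[ x ∈ xs ] (⟦ Q? y ⟧ * g y * (⟦ P? x ⟧ * ⟦ f x ≟ y ⟧))  ≡⟨ ∑-comm ys xs _ ⟩
  ∑[ x ∈ xs ] ∑[ y ∈ ys ] (⟦ Q? y ⟧ * g y * (⟦ P? x ⟧ * ⟦ f x ≟ y ⟧))
    ≡⟨ ∑-cong xs (λ x → ∑-cong ys (λ y → rearrange ⟦ Q? y ⟧ (g y) ⟦ P? x ⟧ ⟦ f x ≟ y ⟧)) ⟩
  ∑[ x ∈ xs ] ∑[ y ∈ ys ] (⟦ P? x ⟧ * (⟦ f x ≟ y ⟧ * (⟦ Q? y ⟧ * g y)))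
    ≡⟨ ∑-cong xs (λ x → ∑-*ˡ ys ⟦ P? x ⟧ _) ⟩
  ∑[ x ∈ xs ] (⟦ P? x ⟧ * ∑[ y ∈ ys ] (⟦ f x ≟ y ⟧ * (⟦ Q? y ⟧ * g y)))
    ≡⟨ ∑-cong xs (λ x → cong (⟦ P? x ⟧ *_) (ys-select (λ y → ⟦ Q? y ⟧ * g y) x)) ⟩
  ∑[ x ∈ xs ] (⟦ P? x ⟧ * (⟦ Q? (f x) ⟧ * g (f x)))                    ≡⟨ ∑-cong xs (λ x → image x (P? x)) ⟩
  ∑[ x ∈ xs ] (⟦ P? x ⟧ * g (f x))                                      ∎)
  where
  open ≡-Reasoning
  rearrange : ∀ q g p e → q * g * (p * e) ≡ p * (e * (q * g))
  rearrange = solve-∀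
  weight : ∀ y → Dec (Q y) → ⟦ Q? y ⟧ * g y ≡ ⟦ Q? y ⟧ * g y * ∑[ x ∈ xs ] (⟦ P? x ⟧ * ⟦ f x ≟ y ⟧)
  weight y (yes q) = trans (sym (*-identityʳ _)) (cong (⟦ Q? y ⟧ * g y *_) (sym (one-preimage y q)))
  weight y (no ¬q) rewrite ⟦⟧-no ¬q (Q? y) = refl
  image : ∀ x → Dec (P x) → ⟦ P? x ⟧ * (⟦ Q? (f x) ⟧ * g (f x)) ≡ ⟦ P? x ⟧ * g (f x)
  image x (yes p) rewrite ⟦⟧-yes (maps-into x p) (Q? (f x)) = cong (⟦ P? x ⟧ *_) (+-identityʳ _)
  image x (no ¬p) rewrite ⟦⟧-no ¬p (P? x) = refl

multiplicity≤length : ∀ {k n} (w : Vec (Fin k) n) c → multiplicity w c ≤ n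
multiplicity≤length {n = n} w c =
  ≤-trans (∑-mono (allFin n) (λ l → ⟦⟧≤1 (lookup w l F.≟ c))) (≤-reflexive (∑<-1 n))

multiplicities : ∀ {k n} → Vec (Fin k) n → Vec (Fin (suc n)) k
multiplicities w = V.tabulate (λ c → fromℕ< (s≤s (multiplicity≤length w c)))

toℕ-multiplicities : ∀ {k n} (w : Vec (Fin k) n) c → toℕ (lookup (multiplicities w) c) ≡ multiplicity w c
toℕ-multiplicities w c = trans (cong toℕ (VP.lookup∘tabulate _ c)) (FP.toℕ-fromℕ< (s≤s (multiplicity≤length w c)))

vsum≡∑ : ∀ {m k} (a : Vec (Fin m) k) → vsum a ≡ ∑[ c < k ] toℕ (lookup a c)
vsum≡∑ [] = refl
vsum≡∑ {k = suc k} (x ∷ a) =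
  trans (cong (toℕ x +_) (vsum≡∑ a)) (sym (∑<-suc k (λ c → toℕ (lookup (x ∷ a) c))))

factProd≡∏ : ∀ {m k} (a : Vec (Fin m) k) → factProd a ≡ ∏[ c < k ] (toℕ (lookup a c) !)
factProd≡∏ [] = refl
factProd≡∏ (x ∷ a) = cong (toℕ x ! *_) (factProd≡∏ a)

∑weaklyIncreasing≡∑compositions : ∀ k n →
  ∑[ w ∈ allVecs k n ] (⟦ weaklyIncreasing? w ⟧ * ∏[ c < k ] (multiplicity w c !))
  ≡ ∑[ a ∈ allVecs (suc n) k ] (⟦ vsum a ≟ n ⟧ * factProd a)
∑weaklyIncreasing≡∑compositions k n = begin
  ∑[ w ∈ allVecs k n ] (⟦ weaklyIncreasing? w ⟧ * ∏[ c < k ] (multiplicity w c !))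
    ≡⟨ ∑-cong (allVecs k n) (λ w → cong (⟦ weaklyIncreasing? w ⟧ *_)
         (sym (trans (factProd≡∏ (multiplicities w)) (∏<-cong k (λ c → cong _! (toℕ-multiplicities w c)))))) ⟩
  ∑[ w ∈ allVecs k n ] (⟦ weaklyIncreasing? w ⟧ * factProd (multiplicities w))
    ≡⟨ ∑-reindex (allVecs k n) (allVecs (suc n) k) weaklyIncreasing? (λ a → vsum a ≟ n) _≟ᵛ_ multiplicities factProd
                 sums-to-n unique-word (λ h w → ∑-allVecs-δ (suc n) k (multiplicities w) h) ⟩
  ∑[ a ∈ allVecs (suc n) k ] (⟦ vsum a ≟ n ⟧ * factProd a) ∎
  where
  open ≡-Reasoning
  sums-to-n : ∀ w → WeaklyIncreasing w → vsum (multiplicities w) ≡ n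
  sums-to-n w _ = trans (vsum≡∑ (multiplicities w)) (trans (∑<-cong k (toℕ-multiplicities w)) (∑-multiplicity w))
  unique-word : ∀ a → vsum a ≡ n →
    ∑[ w ∈ allVecs k n ] (⟦ weaklyIncreasing? w ⟧ * ⟦ multiplicities w ≟ᵛ a ⟧) ≡ 1
  unique-word a ∑a≡n = begin
    ∑[ w ∈ allVecs k n ] (⟦ weaklyIncreasing? w ⟧ * ⟦ multiplicities w ≟ᵛ a ⟧)
      ≡⟨ ∑-cong (allVecs k n) (λ w → trans (sym (⟦⟧-× (weaklyIncreasing? w) (multiplicities w ≟ᵛ a) (both w)))
                                          (⟦⟧-cong (only w) (is w) (both w) (w₀ ≟ᵛ w))) ⟩
    ∑[ w ∈ allVecs k n ] ⟦ w₀ ≟ᵛ w ⟧  ≡⟨ ∑-cong (allVecs k n) (λ w → sym (*-identityʳ _)) ⟩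
    ∑[ w ∈ allVecs k n ] (⟦ w₀ ≟ᵛ w ⟧ * 1) ≡⟨ ∑-allVecs-δ k n w₀ (λ _ → 1) ⟩
    1 ∎
    where
    both : ∀ w → Dec (WeaklyIncreasing w × multiplicities w ≡ a)
    both w = weaklyIncreasing? w ×-dec (multiplicities w ≟ᵛ a)
    A : Fin k → ℕ
    A c = toℕ (lookup a c)
    found = weaklyIncreasing-exists n A (trans (sym (vsum≡∑ a)) ∑a≡n)
    w₀ = proj₁ found
    wi₀ = proj₁ (proj₂ found)
    mult₀ = proj₂ (proj₂ found)
    only : ∀ w → WeaklyIncreasing w × multiplicities w ≡ a → w₀ ≡ w
    only w (wi , refl) = weaklyIncreasing-unique w₀ w wi₀ wi (λ c → trans (mult₀ c) (toℕ-multiplicities w c))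
    is : ∀ w → w₀ ≡ w → WeaklyIncreasing w × multiplicities w ≡ a
    is w refl = wi₀ , trans (VP.tabulate-cong (λ c → FP.toℕ-injective (trans (FP.toℕ-fromℕ< _) (mult₀ c))))
                            (VP.tabulate∘lookup a)

-- multichoose r n counts the multisets of size n drawn from r kinds
multichoose : ℕ → ℕ → ℕ
multichoose r zero = 1
multichoose zero (suc n) = 0
multichoose (suc r) (suc n) = multichoose r (suc n) + multichoose (suc r) n

multichoose≡C : ∀ r n → multichoose (suc r) n ≡ (n + r) C r
multichoose≡C r zero = sym (nCn≡1 r)
multichoose≡C zero (suc n) = multichoose≡C zero n
multichoose≡C (suc r) (suc n) = begin
  multichoose (suc r) (suc n) + multichoose (suc (suc r)) n
    ≡⟨ cong₂ _+_ (multichoose≡C r (suc n)) (multichoose≡C (suc r) n) ⟩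
  (suc n + r) C r + (n + suc r) C suc r
    ≡⟨ cong (λ m → m C r + (n + suc r) C suc r) (sym (+-suc n r)) ⟩
  (n + suc r) C r + (n + suc r) C suc r                    ≡⟨ nCk+nC[k+1]≡[n+1]C[k+1] (n + suc r) r ⟩
  suc (n + suc r) C suc r                                  ∎
  where open ≡-Reasoning

module WeaklyIncreasingWords (k : ℕ) where

  IncreasingFrom : ∀ {n} → ℕ → Vec (Fin k) n → Set
  IncreasingFrom c w = (∀ j → c ≤ toℕ (lookup w j)) × WeaklyIncreasing w

  increasingFrom? : ∀ {n} c (w : Vec (Fin k) n) → Dec (IncreasingFrom c w)
  increasingFrom? c w = FP.all? (λ j → c ≤? toℕ (lookup w j)) ×-dec weaklyIncreasing? w

  wordsFrom : ℕ → ℕ → ℕ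
  wordsFrom n c = ∑[ w ∈ allVecs k n ] ⟦ increasingFrom? c w ⟧

  increasingFrom-∷ : ∀ {n} c x (v : Vec (Fin k) n) →
    IncreasingFrom c (x ∷ v) ⇔ (c ≤ toℕ x × IncreasingFrom (toℕ x) v)
  increasingFrom-∷ c x v = mk⇔
    (λ (c≤ , wi) → c≤ fz , (λ j → wi fz (fs j) (s≤s z≤n)) , (λ i j i<j → wi (fs i) (fs j) (s≤s i<j)))
    (λ (c≤x , x≤ , wi) → (λ { fz → c≤x ; (fs j) → ≤-trans c≤x (x≤ j) })
                        , λ { fz (fs j) _ → x≤ j ; (fs i) (fs j) i<j → wi i j (s≤s⁻¹ i<j) })

  wordsFrom-suc : ∀ n c → wordsFrom (suc n) c ≡ ∑[ x < k ] (⟦ c ≤? toℕ x ⟧ * wordsFrom n (toℕ x))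
  wordsFrom-suc n c = trans (∑-allVecs-suc k n _) (∑<-cong k (λ x →
    trans (∑-cong (allVecs k n) (first-letter x)) (∑-*ˡ (allVecs k n) ⟦ c ≤? toℕ x ⟧ _)))
    where
    first-letter : ∀ x v → ⟦ increasingFrom? c (x ∷ v) ⟧ ≡ ⟦ c ≤? toℕ x ⟧ * ⟦ increasingFrom? (toℕ x) v ⟧
    first-letter x v = trans (⟦⟧-cong (Equivalence.to (increasingFrom-∷ c x v)) (Equivalence.from (increasingFrom-∷ c x v))
                                      (increasingFrom? c (x ∷ v)) ((c ≤? toℕ x) ×-dec increasingFrom? (toℕ x) v))
                             (⟦⟧-× (c ≤? toℕ x) (increasingFrom? (toℕ x) v) _)

  ⟦≤⟧-split : ∀ c (x : Fin k) (c<k : c < k) → ⟦ c ≤? toℕ x ⟧ ≡ ⟦ c <? toℕ x ⟧ + ⟦ fromℕ< c<k F.≟ x ⟧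
  ⟦≤⟧-split c x c<k = trans (⟦⟧-split (c <? toℕ x) (c ≤? toℕ x)) (cong₂ _+_
    (⟦⟧-cong proj₁ (λ c<x → c<x , <⇒≤ c<x) ((c <? toℕ x) ×-dec (c ≤? toℕ x)) (c <? toℕ x))
    (⟦⟧-cong (λ (c≮x , c≤x) → FP.toℕ-injective (trans toℕ-c (≤-antisym c≤x (≮⇒≥ c≮x))))
             (λ { refl → <-irrefl (sym toℕ-c) , ≤-reflexive (sym toℕ-c) })
             (¬? (c <? toℕ x) ×-dec (c ≤? toℕ x)) (fromℕ< c<k F.≟ x)))
    where toℕ-c = FP.toℕ-fromℕ< c<k

  ∑≥-multichoose : ∀ n r c → r + c ≡ k →
    ∑[ x < k ] (⟦ c ≤? toℕ x ⟧ * multichoose (k ∸ toℕ x) n) ≡ multichoose r (suc n)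
  ∑≥-multichoose n zero c refl =
    ∑-zero (allFin k) (λ x → cong (_* multichoose (k ∸ toℕ x) n) (⟦⟧-no (<⇒≱ (FP.toℕ<n x)) (c ≤? toℕ x)))
  ∑≥-multichoose n (suc r) c r+c≡k = begin
    ∑[ x < k ] (⟦ c ≤? toℕ x ⟧ * M x)
      ≡⟨ ∑<-cong k (λ x → trans (cong (_* M x) (⟦≤⟧-split c x c<k))
                                (*-distribʳ-+ (M x) ⟦ c <? toℕ x ⟧ ⟦ fromℕ< c<k F.≟ x ⟧)) ⟩
    ∑[ x < k ] (⟦ c <? toℕ x ⟧ * M x + ⟦ fromℕ< c<k F.≟ x ⟧ * M x)   ≡⟨ ∑-+ (allFin k) _ _ ⟩
    ∑[ x < k ] (⟦ c <? toℕ x ⟧ * M x) + ∑[ x < k ] (⟦ fromℕ< c<k F.≟ x ⟧ * M x)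
      ≡⟨ cong₂ _+_ (∑≥-multichoose n r (suc c) (trans (+-suc r c) r+c≡k)) (∑<-δ k (fromℕ< c<k) M) ⟩
    multichoose r (suc n) + M (fromℕ< c<k)
      ≡⟨ cong (λ m → multichoose r (suc n) + multichoose (k ∸ m) n) (FP.toℕ-fromℕ< c<k) ⟩
    multichoose r (suc n) + multichoose (k ∸ c) n
      ≡⟨ cong (λ m → multichoose r (suc n) + multichoose m n)
              (trans (cong (_∸ c) (sym r+c≡k)) (m+n∸n≡m (suc r) c)) ⟩
    multichoose (suc r) (suc n) ∎
    where
    open ≡-Reasoning
    M : Fin k → ℕ
    M x = multichoose (k ∸ toℕ x) n
    c<k : c < k
    c<k = ≤-trans (s≤s (m≤n+m c r)) (≤-reflexive r+c≡k)

  wordsFrom≡multichoose : ∀ n c → c ≤ k → wordsFrom n c ≡ multichoose (k ∸ c) n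
  wordsFrom≡multichoose zero c _ = refl
  wordsFrom≡multichoose (suc n) c c≤k = begin
    wordsFrom (suc n) c                                       ≡⟨ wordsFrom-suc n c ⟩
    ∑[ x < k ] (⟦ c ≤? toℕ x ⟧ * wordsFrom n (toℕ x))
      ≡⟨ ∑<-cong k (λ x → cong (⟦ c ≤? toℕ x ⟧ *_) (wordsFrom≡multichoose n (toℕ x) (<⇒≤ (FP.toℕ<n x)))) ⟩
    ∑[ x < k ] (⟦ c ≤? toℕ x ⟧ * multichoose (k ∸ toℕ x) n)
      ≡⟨ ∑≥-multichoose n (k ∸ c) c (m∸n+n≡m c≤k) ⟩
    multichoose (k ∸ c) (suc n)                               ∎
    where open ≡-Reasoning

  count-weaklyIncreasing : ∀ n → ∑[ w ∈ allVecs k n ] ⟦ weaklyIncreasing? w ⟧ ≡ multichoose k n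
  count-weaklyIncreasing n = trans
    (∑-cong (allVecs k n) (λ w → ⟦⟧-cong ((λ _ → z≤n) ,_) proj₂ (weaklyIncreasing? w) (increasingFrom? 0 w)))
    (wordsFrom≡multichoose n 0 z≤n)

theorem7 : ∀ (n k : ℕ) → 1 ≤ n → 1 ≤ k →
    (Av Υ₁ n k ≡ sum (map factProd (compositions n k)))
      × (Av Υ₂ n k ≡ (n + k ∸ 1) C (k ∸ 1))
theorem7 n k@(suc k′) _ _ = part₁ , part₂
  where
  open ≡-Reasoning
  part₁ : Av Υ₁ n k ≡ sum (map factProd (compositions n k))
  part₁ = begin
    Av Υ₁ n k                                                                        ≡⟨ Av≡∑∑ Υ₁ n k ⟩
    ∑[ w ∈ allVecs k n ] ∑[ σ ∈ allVecs n n ] (⟦ isPerm? σ ⟧ * ⟦ biAvoids? Υ₁ (σ , w) ⟧)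
      ≡⟨ ∑-cong (allVecs k n) Colouring.avoiders₁ ⟩
    ∑[ w ∈ allVecs k n ] (⟦ weaklyIncreasing? w ⟧ * ∏[ c < k ] (multiplicity w c !))
      ≡⟨ ∑weaklyIncreasing≡∑compositions k n ⟩
    ∑[ a ∈ allVecs (suc n) k ] (⟦ vsum a ≟ n ⟧ * factProd a)
      ≡⟨ sym (∑-filter (λ a → vsum a ≟ n) (allVecs (suc n) k) factProd) ⟩
    ∑ (compositions n k) factProd
      ≡⟨ sym (sum-map factProd (compositions n k)) ⟩
    sum (map factProd (compositions n k))                                            ∎
  part₂ : Av Υ₂ n k ≡ (n + k ∸ 1) C (k ∸ 1)
  part₂ = begin
    Av Υ₂ n k                                                                        ≡⟨ Av≡∑∑ Υ₂ n k ⟩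
    ∑[ w ∈ allVecs k n ] ∑[ σ ∈ allVecs n n ] (⟦ isPerm? σ ⟧ * ⟦ biAvoids? Υ₂ (σ , w) ⟧)
      ≡⟨ ∑-cong (allVecs k n) Colouring.avoiders₂ ⟩
    ∑[ w ∈ allVecs k n ] ⟦ weaklyIncreasing? w ⟧
      ≡⟨ WeaklyIncreasingWords.count-weaklyIncreasing k n ⟩
    multichoose k n                                                                  ≡⟨ multichoose≡C k′ n ⟩
    (n + k′) C k′
      ≡⟨ cong (λ m → (m ∸ 1) C k′) (sym (+-suc n k′)) ⟩
    (n + k ∸ 1) C (k ∸ 1)                                                            ∎
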